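{- $(\mathcal{H},*,1_{X^*},\Delta,\epsilon)$ is a Hopf algebra.
   Context: Let $k$ be a field, $X=\{x_i\}_{i\ge 0}$ an alphabet indexed by the nonnegative integers and $X^*$ the set of words over $X$, with empty word $1_{X^*}$. For a word $w=x_{i_1}\cdots x_{i_m}$, $|w|=m$, $w[j]$ is its $j$-th letter, $Alph(w)$ the set of letters occurring in $w$, $IAlph(w)=\{i_1,\dots,i_m\}$, $sup(w)=\max IAlph(w)$ ($sup(w)=0$ if $IAlph(w)=\emptyset$). For $\phi$ on $IAlph(w)$ with values in $\mathbb{N}$ and $\phi(0)=0$, $S_\phi(w)=x_{\phi(i_1)}\cdots x_{\phi(i_m)}$. If $IAlph(w)\setminus\{0\}=\{j_1<\dots<j_k\}$, let $\phi_w(j_m)=m$, $\phi_w(0)=0$, $pack(w)=S_{\phi_w}(w)$; $w$ is packed if $pack(w)=w$. For $t\in\mathbb{N}$, $T_t(w)=S_\phi(w)$ with $\phi(0)=0$, $\phi(n)=n+t$ for $n>0$. Shifted concatenation: $u*v=u\,T_{sup(u)}(v)$. $\mathcal{H}$ is the $k$-vector space with basis the packed words, with product $*$ extended bilinearly and unit $1_{X^*}$. For $L=\{l_1<\dots<l_r\}\subseteq[1\dots|w|]$, $w[L]=w[l_1]\cdots w[l_r]$. For $A\subseteq X$, $w/A=S_{\phi_A}(w)$ where $\phi_A(i)=0$ if $x_i\in A$ and $\phi_A(i)=i$ otherwise; ${}^{w}/_{u}=w/Alph(u)$. The coproduct is defined on packed words by $\Delta(w)=\sum pack(w[I])\otimes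 pack({}^{w[J]}/_{w[I]})$, the sum over ordered pairs $(I,J)$ of disjoint sets with $I\cup J=[1\dots|w|]$, extended linearly; the counit $\epsilon$ is $\epsilon(1_{X^*})=1$ and $\epsilon(w)=0$ for non-empty packed words $w$. -}

module Defs where

open import Level using (Level; _⊔_)
open import Data.Nat as ℕ using (ℕ; zero; suc; _⊔_; _≤?_)
open import Data.Nat.Properties using (_≟_)
open import Data.Bool.ListAction using (any)
open import Relation.Nullary.Decidable using (¬?)
open import Data.Bool using (Bool; true; false; if_then_else_)
open import Data.List as L using (List; []; _∷_; map; filter; concatMap; length; deduplicate; foldr; _++_)
open import Data.List.Relation.Unary.All using (All)
open import Data.Product using (Σ; ∃; _×_; _,_; proj₁; proj₂)
import Data.List.Properties as LP
import Data.Product.Properties as PP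
open import Relation.Nullary using (¬_; Dec; yes; no; does)
open import Relation.Binary.PropositionalEquality using (_≡_)
open import Relation.Binary.Definitions using (DecidableEquality)
open import Algebra.Bundles using (CommutativeRing)

record Field (c ℓ : Level) : Set (Level.suc (c Level.⊔ ℓ)) where
  field
    commutativeRing : CommutativeRing c ℓ
  open CommutativeRing commutativeRing public
  field
    0≉1     : ¬ (0# ≈ 1#)
    inverse : ∀ x → ¬ (x ≈ 0#) → Σ Carrier λ y → x * y ≈ 1#

-- Words over X = {x_i}_{i ≥ 0}: the letter x_i is represented by i.

Word : Set
Word = List ℕ

_≟W_ : DecidableEquality Word
_≟W_ = LP.≡-dec _≟_

isZero : ℕ → Bool
isZero zero    = true
isZero (suc _) = false

sup : Word → ℕ
sup = foldr ℕ._⊔_ 0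

S : (ℕ → ℕ) → Word → Word
S φ = map φ

nzAlph : Word → List ℕ
nzAlph w = deduplicate _≟_ (filter (λ i → ¬? (i ≟ 0)) w)

-- φ_w : φ_w(0) = 0 and φ_w(j_m) = m where j_1 < ... < j_k enumerate
-- IAlph(w) \ {0}; i.e. φ_w(j) = #{ j' ∈ IAlph(w)\{0} | j' ≤ j }.
φ : Word → ℕ → ℕ
φ w zero    = zero
φ w (suc i) = length (filter (λ j → j ≤? suc i) (nzAlph w))

pack : Word → Word
pack w = S (φ w) w

Packed : Word → Set
Packed w = pack w ≡ w

T : ℕ → Word → Word
T t = S (λ { zero → zero ; (suc n) → suc n ℕ.+ t })

_⋆_ : Word → Word → Word
u ⋆ v = u ++ T (sup u) v

_/_ : Word → List ℕ → Word
w / A = S (λ i → if any (λ a → does (a ≟ i)) A then 0 else i) w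

-- Enumeration of the ordered pairs (w[I], w[J]) with I ⊎ J = [1..|w|]
-- (each position goes either to I or to J; subwords keep the order).

splits : Word → List (Word × Word)
splits []      = ([] , []) ∷ []
splits (x ∷ w) = concatMap (λ p → (x ∷ proj₁ p , proj₂ p) ∷ (proj₁ p , x ∷ proj₂ p) ∷ []) (splits w)

Δw : Word → List (Word × Word)
Δw w = map (λ p → pack (proj₁ p) , pack (proj₂ p / proj₁ p)) (splits w)

-- Free k-modules: formal finite linear combinations over a basis B
-- with decidable equality, compared coefficientwise.

module FreeModule {c ℓ : Level} (k : Field c ℓ) where
  open Field k

  Lin : Set → Set c
  Lin B = List (Carrier × B)

  coeff : {B : Set} → DecidableEquality B → Lin B → B → Carrier
  coeff _≟_ []            b = 0#
  coeff _≟_ ((a , b') ∷ x) b with b' ≟ b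
  ... | yes _ = a + coeff _≟_ x b
  ... | no  _ = coeff _≟_ x b

  Eq : {B : Set} → DecidableEquality B → Lin B → Lin B → Set ℓ
  Eq _≟_ x y = ∀ b → coeff _≟_ x b ≈ coeff _≟_ y b

  scale : {B : Set} → Carrier → Lin B → Lin B
  scale a = map (λ p → a * proj₁ p , proj₂ p)

  extend : {B C : Set} → (B → Lin C) → Lin B → Lin C
  extend f = concatMap (λ p → scale (proj₁ p) (f (proj₂ p)))

  extend₂ : {B C D : Set} → (B → C → Lin D) → Lin B → Lin C → Lin D
  extend₂ f x y = extend (λ b → extend (λ c → f b c) y) x

  -- The spaces H, H ⊗ H, H ⊗ H ⊗ H (bases: packed words, pairs, triples)

  W2 W3 : Set
  W2 = Word × Word
  W3 = Word × Word × Word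

  _≟2_ : DecidableEquality W2
  _≟2_ = PP.≡-dec _≟W_ _≟W_

  _≟3_ : DecidableEquality W3
  _≟3_ = PP.≡-dec _≟W_ _≟2_

  InH : Lin Word → Set c
  InH x = All (λ p → Packed (proj₂ p)) x

  InH⊗H : Lin W2 → Set c
  InH⊗H x = All (λ p → Packed (proj₁ (proj₂ p)) × Packed (proj₂ (proj₂ p))) x

  _≋_ : Lin Word → Lin Word → Set ℓ
  _≋_ = Eq _≟W_

  _≋2_ : Lin W2 → Lin W2 → Set ℓ
  _≋2_ = Eq _≟2_

  _≋3_ : Lin W3 → Lin W3 → Set ℓ
  _≋3_ = Eq _≟3_

  mul : Lin Word → Lin Word → Lin Word
  mul = extend₂ (λ u v → (1# , u ⋆ v) ∷ [])

  unit : Lin Word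
  unit = (1# , []) ∷ []

  Δ : Lin Word → Lin W2
  Δ = extend (λ w → map (λ p → 1# , p) (Δw w))

  εw : Word → Carrier
  εw []      = 1#
  εw (_ ∷ _) = 0#

  ε : Lin Word → Carrier
  ε = foldr (λ p s → proj₁ p * εw (proj₂ p) + s) 0#

  mul2 : Lin W2 → Lin W2 → Lin W2
  mul2 = extend₂ (λ p q → (1# , (proj₁ p ⋆ proj₁ q , proj₂ p ⋆ proj₂ q)) ∷ [])

  unit2 : Lin W2
  unit2 = (1# , ([] , [])) ∷ []

  Δ⊗id : Lin W2 → Lin W3
  Δ⊗id = extend (λ p → map (λ q → 1# , (proj₁ (proj₂ q) , proj₂ (proj₂ q) , proj₂ p)) (Δ ((1# , proj₁ p) ∷ [])))

  id⊗Δ : Lin W2 → Lin W3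
  id⊗Δ = extend (λ p → map (λ q → 1# , (proj₁ p , proj₁ (proj₂ q) , proj₂ (proj₂ q))) (Δ ((1# , proj₂ p) ∷ [])))

  ε⊗id : Lin W2 → Lin Word
  ε⊗id = extend (λ p → (εw (proj₁ p) , proj₂ p) ∷ [])

  id⊗ε : Lin W2 → Lin Word
  id⊗ε = extend (λ p → (εw (proj₂ p) , proj₁ p) ∷ [])

  m∘⊗ : (Lin Word → Lin Word) → (Lin Word → Lin Word) → Lin W2 → Lin Word
  m∘⊗ f g = extend (λ p → mul (f ((1# , proj₁ p) ∷ [])) (g ((1# , proj₂ p) ∷ [])))

  ηε : Lin Word → Lin Word
  ηε x = (ε x , []) ∷ []

  record IsLinearEndo (f : Lin Word → Lin Word) : Set (c Level.⊔ ℓ) where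
    field
      preservesH : ∀ x → InH x → InH (f x)
      cong       : ∀ x y → InH x → InH y → x ≋ y → f x ≋ f y
      additive   : ∀ x y → InH x → InH y → f (x ++ y) ≋ (f x ++ f y)
      homogeneous : ∀ a x → InH x → f (scale a x) ≋ scale a (f x)

  record IsHopfAlgebra : Set (c Level.⊔ Level.suc ℓ) where
    field
      mul-closed  : ∀ x y → InH x → InH y → InH (mul x y)
      unit-closed : InH unit
      Δ-closed    : ∀ x → InH x → InH⊗H (Δ x)
      mul-cong : ∀ x x' y y' → InH x → InH x' → InH y → InH y' → x ≋ x' → y ≋ y' → mul x y ≋ mul x' y'
      Δ-cong   : ∀ x y → InH x → InH y → x ≋ y → Δ x ≋2 Δ y
      ε-cong   : ∀ x y → InH x → InH y → x ≋ y → ε x ≈ ε y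
      mul-assoc : ∀ x y z → InH x → InH y → InH z → mul (mul x y) z ≋ mul x (mul y z)
      mul-unitˡ : ∀ x → InH x → mul unit x ≋ x
      mul-unitʳ : ∀ x → InH x → mul x unit ≋ x
      Δ-coassoc : ∀ x → InH x → Δ⊗id (Δ x) ≋3 id⊗Δ (Δ x)
      ε-counitˡ : ∀ x → InH x → ε⊗id (Δ x) ≋ x
      ε-counitʳ : ∀ x → InH x → id⊗ε (Δ x) ≋ x
      Δ-mul  : ∀ x y → InH x → InH y → Δ (mul x y) ≋2 mul2 (Δ x) (Δ y)
      Δ-unit : Δ unit ≋2 unit2
      ε-mul  : ∀ x y → InH x → InH y → ε (mul x y) ≈ ε x * ε y
      ε-unit : ε unit ≈ 1#
      antipode        : Lin Word → Lin Word
      antipode-linear : IsLinearEndo antipode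
      antipode-left   : ∀ x → InH x → m∘⊗ antipode (λ y → y) (Δ x) ≋ ηε x
      antipode-right  : ∀ x → InH x → m∘⊗ (λ y → y) antipode (Δ x) ≋ ηε x

-- Two combinations are
-- equal coefficientwise iff they have the same evaluation ⟦ x ⟧ g = Σ a·g(b)
-- against every weight g : B → k; evaluation turns mul, Δ, ε and the tensor
-- maps into iterated finite sums over words and over the splittings of words.  The antipode is Takeuchi's: the
-- recursively defined left and right convolution inverses of the identity,
-- which coincide because convolution is associative.

module Submission where

open import Level using (Level)
open import Defs

module Words where

  open import Data.Nat using (ℕ; zero; suc; _≤_; _<_; _≤?_; _+_; _⊔_; _≡ᵇ_; z≤n; s≤s; z<s)
  open import Data.Nat.Properties
  open import Data.List using (List; []; _∷_; map; filter; length; _++_; concatMap; null; filterᵇ)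
  open import Data.List.Properties
    using (length-++; length-map; map-++; map-∘; ++-assoc; ++-identityʳ; map-id; map-cong-local; concatMap-map; map-concatMap)
  open import Data.List.Membership.Propositional using (_∈_; _∉_; find)
  open import Data.List.Membership.Propositional.Properties
  open import Data.List.Membership.DecPropositional _≟_ using (_∈?_)
  open import Data.List.Relation.Unary.Any using (here; there)
  open import Data.List.Relation.Unary.All as All using (All; []; _∷_)
  import Data.List.Relation.Unary.All.Properties as AllP
  open import Data.List.Relation.Unary.AllPairs using ([]; _∷_)
  open import Data.List.Relation.Unary.Unique.Propositional using (Unique)
  import Data.List.Relation.Unary.Unique.DecPropositional.Properties as UniqueDec
  import Data.List.Relation.Unary.Unique.Propositional.Properties as Unique
  open import Data.Product using (Σ; _×_; _,_; proj₁; proj₂)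
  open import Data.Sum using (_⊎_; inj₁; inj₂; [_,_]′)
  open import Data.Bool using (Bool; true; false; if_then_else_; not) renaming (T to True)
  open import Data.Bool.ListAction using (any)
  open import Data.List.Relation.Binary.Subset.Propositional.Properties using (map⁺)
  open import Data.Empty using (⊥-elim)
  open import Function using (_∘_)
  open import Relation.Binary.PropositionalEquality
  open import Relation.Binary.Definitions using (tri<; tri≈; tri>)
  open import Relation.Nullary using (¬_; yes; no; does)
  open import Relation.Nullary.Decidable using (¬?; T?)

  map-cong-∈ : ∀ {A B : Set} {f g : A → B} (xs : List A) → (∀ {x} → x ∈ xs → f x ≡ g x) → map f xs ≡ map g xs
  map-cong-∈ xs h = map-cong-local (All.tabulate h)

  length-⊆ : ∀ {xs ys : List ℕ} → Unique xs → (∀ {m} → m ∈ xs → m ∈ ys) → length xs ≤ length ys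
  length-⊆ {[]} _ _ = z≤n
  length-⊆ {x ∷ xs} {ys} (x∉xs ∷ u) sub with ∈-∃++ (sub (here refl))
  ... | as , bs , refl =
    subst (suc (length xs) ≤_) (sym (trans (length-++ as) (+-suc (length as) (length bs))))
      (s≤s (subst (length xs ≤_) (length-++ as) (length-⊆ u sub')))
    where
    sub' : ∀ {m} → m ∈ xs → m ∈ as ++ bs
    sub' {m} m∈ with ∈-++⁻ as (sub (there m∈))
    ... | inj₁ p = ∈-++⁺ˡ p
    ... | inj₂ (here refl) = ⊥-elim (All.lookup x∉xs m∈ refl)
    ... | inj₂ (there p) = ∈-++⁺ʳ as p

  unique-map : ∀ {f : ℕ → ℕ} {xs : List ℕ} → (∀ {a b} → a ∈ xs → b ∈ xs → f a ≡ f b → a ≡ b) → Unique xs → Unique (map f xs)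
  unique-map {f} {[]} inj u = []
  unique-map {f} {x ∷ xs} inj (x∉xs ∷ u) =
    AllP.map⁺ (All.tabulate (λ {z} z∈ eq → All.lookup x∉xs z∈ (inj (here refl) (there z∈) eq)))
    ∷ unique-map (λ a b → inj (there a) (there b)) u

  concatMap-cong-∈ : ∀ {a b : Level} {A : Set a} {B : Set b} {f g : A → List B} (xs : List A) → (∀ {x} → x ∈ xs → f x ≡ g x) → concatMap f xs ≡ concatMap g xs
  concatMap-cong-∈ [] h = refl
  concatMap-cong-∈ (x ∷ xs) h = cong₂ _++_ (h (here refl)) (concatMap-cong-∈ xs (λ m → h (there m)))

  filterᵇ-map : ∀ {A B : Set} (test : B → Bool) (f : A → B) l → filterᵇ test (map f l) ≡ map f (filterᵇ (test ∘ f) l)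
  filterᵇ-map test f [] = refl
  filterᵇ-map test f (x ∷ l) with test (f x)
  ... | true = cong (f x ∷_) (filterᵇ-map test f l)
  ... | false = filterᵇ-map test f l

  filterᵇ-cong : ∀ {A : Set} {test test' : A → Bool} l → (∀ x → test x ≡ test' x) → filterᵇ test l ≡ filterᵇ test' l
  filterᵇ-cong [] _ = refl
  filterᵇ-cong {test = test} {test'} (x ∷ l) same rewrite same x with test' x
  ... | true = cong (x ∷_) (filterᵇ-cong l same)
  ... | false = filterᵇ-cong l same

  null-map : ∀ {A B : Set} (f : A → B) l → null (map f l) ≡ null l
  null-map f [] = refl
  null-map f (x ∷ l) = refl

  below : Word → ℕ → List ℕ
  below y j = filter (λ m → m ≤? j) (nzAlph y)

  below-unique : ∀ y j → Unique (below y j)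
  below-unique y j = Unique.filter⁺ (λ m → m ≤? j) (UniqueDec.deduplicate-! _≟_ (filter (λ i → ¬? (i ≟ 0)) y))

  ∈-below⁻ : ∀ y j {m} → m ∈ below y j → m ∈ y × m ≢ 0 × m ≤ j
  ∈-below⁻ y j {m} m∈ with ∈-filter⁻ (λ m → m ≤? j) {xs = nzAlph y} m∈
  ... | m∈nz , m≤j with ∈-filter⁻ (λ i → ¬? (i ≟ 0)) {xs = y} (∈-deduplicate⁻ _≟_ (filter (λ i → ¬? (i ≟ 0)) y) m∈nz)
  ... | m∈y , m≢0 = m∈y , m≢0 , m≤j

  ∈-below⁺ : ∀ y j {m} → m ∈ y → m ≢ 0 → m ≤ j → m ∈ below y j
  ∈-below⁺ y j m∈y m≢0 m≤j =
    ∈-filter⁺ (λ m → m ≤? j) (∈-deduplicate⁺ _≟_ (∈-filter⁺ (λ i → ¬? (i ≟ 0)) m∈y m≢0)) m≤j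

  φ≡length-below : ∀ y j → φ y j ≡ length (below y j)
  φ≡length-below y zero = sym (n≤0⇒n≡0 (length-⊆ {ys = []} (below-unique y 0) λ m∈ →
    let (_ , m≢0 , m≤0) = ∈-below⁻ y 0 m∈ in ⊥-elim (m≢0 (n≤0⇒n≡0 m≤0))))
  φ≡length-below y (suc j) = refl

  φ-count : ∀ y j (ms : List ℕ) → Unique ms → (∀ {m} → m ∈ ms → m ∈ y × m ≢ 0 × m ≤ j)
          → (∀ {m} → m ∈ y → m ≢ 0 → m ≤ j → m ∈ ms) → φ y j ≡ length ms
  φ-count y j ms u sound complete = trans (φ≡length-below y j) (≤-antisym
    (length-⊆ (below-unique y j) (λ m∈ → let (a , b , c) = ∈-below⁻ y j m∈ in complete a b c))
    (length-⊆ u (λ m∈ → let (a , b , c) = sound m∈ in ∈-below⁺ y j a b c)))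

  φ-monotone : ∀ y {i j} → i ≤ j → φ y i ≤ φ y j
  φ-monotone y {i} {j} i≤j rewrite φ≡length-below y i | φ≡length-below y j =
    length-⊆ (below-unique y i) (λ m∈ → let (a , b , c) = ∈-below⁻ y i m∈ in ∈-below⁺ y j a b (≤-trans c i≤j))

  φ-positive : ∀ y {j} → j ∈ y → j ≢ 0 → Σ ℕ λ t → φ y j ≡ suc t
  φ-positive y {j} j∈y j≢0 with φ y j | φ≡length-below y j
  ... | zero | eq = ⊥-elim (1+n≰n (subst (1 ≤_) (sym eq)
         (length-⊆ {xs = j ∷ []} ([] ∷ []) (λ { (here refl) → ∈-below⁺ y j j∈y j≢0 ≤-refl }))))
  ... | suc t | _ = t , refl

  -- Packing
  -- forgets such relabellings; φ y itself is one, so pack is idempotent.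

  LettersIn : Word → Word → Set
  LettersIn a z = ∀ {m} → m ∈ a → m ≡ 0 ⊎ m ∈ z

  OrderPreserving : (ℕ → ℕ) → Word → Set
  OrderPreserving ψ y = (ψ 0 ≡ 0) × (∀ {i j} → (i ≡ 0 ⊎ i ∈ y) → j ∈ y → i < j → ψ i < ψ j)

  above⇒∈ : ∀ {y a b} → (b ≡ 0 ⊎ b ∈ y) → a < b → b ∈ y
  above⇒∈ (inj₁ refl) a<b = ⊥-elim (n≮0 a<b)
  above⇒∈ (inj₂ b∈) _ = b∈

  OrderPreserving-⊆ : ∀ {ψ z y} → OrderPreserving ψ z → LettersIn y z → OrderPreserving ψ y
  OrderPreserving-⊆ (ψ0 , incr) y⊆z = ψ0 , λ
    { (inj₁ i≡0) j∈ i<j → incr (inj₁ i≡0) (above⇒∈ (y⊆z j∈) i<j) i<j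
    ; (inj₂ i∈) j∈ i<j → incr (y⊆z i∈) (above⇒∈ (y⊆z j∈) i<j) i<j }

  OrderPreserving-nonzero : ∀ {ψ y j} → OrderPreserving ψ y → j ∈ y → j ≢ 0 → ψ j ≢ 0
  OrderPreserving-nonzero {j = zero} _ _ j≢0 = ⊥-elim (j≢0 refl)
  OrderPreserving-nonzero {ψ} {j = suc j} (ψ0 , incr) j∈ _ eq =
    <-irrefl refl (subst (0 <_) eq (subst (_< ψ (suc j)) ψ0 (incr (inj₁ refl) j∈ z<s)))

  OrderPreserving-injective : ∀ {ψ y i j} → OrderPreserving ψ y → (i ≡ 0 ⊎ i ∈ y) → (j ≡ 0 ⊎ j ∈ y) → ψ i ≡ ψ j → i ≡ j
  OrderPreserving-injective {i = i} {j} (_ , incr) hi hj eq with <-cmp i j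
  ... | tri≈ _ i≡j _ = i≡j
  ... | tri< i<j _ _ = ⊥-elim (<⇒≢ (incr hi (above⇒∈ hj i<j) i<j) eq)
  ... | tri> _ _ j<i = ⊥-elim (<⇒≢ (incr hj (above⇒∈ hi j<i) j<i) (sym eq))

  OrderPreserving-reflects-≤ : ∀ {ψ y i j} → OrderPreserving ψ y → i ∈ y → j ∈ y → ψ i ≤ ψ j → i ≤ j
  OrderPreserving-reflects-≤ {i = i} {j} (_ , incr) i∈ j∈ ψi≤ψj with i ≤? j
  ... | yes i≤j = i≤j
  ... | no i≰j = ⊥-elim (<⇒≱ (incr (inj₂ j∈) i∈ (≰⇒> i≰j)) ψi≤ψj)

  φ-orderPreserving : ∀ y → OrderPreserving (φ y) y
  φ-orderPreserving y = refl , λ {i} {j} _ j∈ i<j → increasing i<j j∈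
    where
    increasing : ∀ {i j} → i < j → j ∈ y → φ y i < φ y j
    increasing {i} {j} i<j j∈ rewrite φ≡length-below y i | φ≡length-below y j =
      length-⊆ {xs = j ∷ below y i}
        (All.tabulate (λ {z} z∈ eq → <⇒≢ (≤-<-trans (proj₂ (proj₂ (∈-below⁻ y i z∈))) i<j) (sym eq)) ∷ below-unique y i)
        λ { (here refl) → ∈-below⁺ y j j∈ (λ { refl → n≮0 i<j }) ≤-refl
          ; (there z∈) → let (a , b , c) = ∈-below⁻ y i z∈ in ∈-below⁺ y j a b (≤-trans c (<⇒≤ i<j)) }

  pack-relabel : ∀ {ψ} y → OrderPreserving ψ y → pack (map ψ y) ≡ pack y
  pack-relabel {ψ} y op@(ψ0 , incr) = trans (sym (map-∘ y)) (map-cong-∈ y same-rank)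
    where
    same-rank : ∀ {i} → i ∈ y → φ (map ψ y) (ψ i) ≡ φ y i
    same-rank {zero} i∈ rewrite ψ0 = refl
    same-rank {suc i} i∈ with ψ (suc i) in eqψ
    ... | zero = ⊥-elim (OrderPreserving-nonzero op i∈ (λ ()) eqψ)
    ... | suc ψi =
      trans (φ-count (map ψ y) (suc ψi) (map ψ (below y (suc i)))
        (unique-map (λ a b → OrderPreserving-injective op (inj₂ (proj₁ (∈-below⁻ y _ a))) (inj₂ (proj₁ (∈-below⁻ y _ b))))
          (below-unique y _))
        sound complete)
       (trans (length-map ψ (below y (suc i))) (sym (φ≡length-below y (suc i))))
      where
      sound : ∀ {m'} → m' ∈ map ψ (below y (suc i)) → m' ∈ map ψ y × m' ≢ 0 × m' ≤ suc ψi
      sound m'∈ with ∈-map⁻ ψ m'∈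
      ... | m , m∈ , refl with ∈-below⁻ y (suc i) m∈
      ... | m∈y , m≢0 , m≤ = ∈-map⁺ ψ m∈y , OrderPreserving-nonzero op m∈y m≢0 ,
            subst (ψ m ≤_) eqψ (monotone (m≤n⇒m<n∨m≡n m≤))
        where
        monotone : m < suc i ⊎ m ≡ suc i → ψ m ≤ ψ (suc i)
        monotone (inj₁ m<) = <⇒≤ (incr (inj₂ m∈y) i∈ m<)
        monotone (inj₂ refl) = ≤-refl
      complete : ∀ {m'} → m' ∈ map ψ y → m' ≢ 0 → m' ≤ suc ψi → m' ∈ map ψ (below y (suc i))
      complete m'∈ m'≢0 m'≤ with ∈-map⁻ ψ m'∈
      ... | m , m∈ , refl = ∈-map⁺ ψ (∈-below⁺ y (suc i) m∈ (λ { refl → m'≢0 ψ0 })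
            (OrderPreserving-reflects-≤ op m∈ i∈ (subst (ψ m ≤_) (sym eqψ) m'≤)))

  pack-idem : ∀ y → pack (pack y) ≡ pack y
  pack-idem y = pack-relabel y (φ-orderPreserving y)

  erase : List ℕ → ℕ → ℕ
  erase A i = if any (λ a → does (a ≟ i)) A then 0 else i

  any≡true⇒∈ : ∀ A i → any (λ a → does (a ≟ i)) A ≡ true → i ∈ A
  any≡true⇒∈ (a ∷ A) i eq with a ≡ᵇ i in a≡ᵇi
  ... | true = here (sym (≡ᵇ⇒≡ a i (subst True (sym a≡ᵇi) _)))
  ... | false = there (any≡true⇒∈ A i eq)

  erase-∈ : ∀ {A i} → i ∈ A → erase A i ≡ 0
  erase-∈ {a ∷ A} (here refl) with a ≡ᵇ a in a≡ᵇa
  ... | true = refl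
  ... | false = ⊥-elim (subst True a≡ᵇa (≡⇒≡ᵇ a a refl))
  erase-∈ {a ∷ A} {i} (there i∈) with a ≡ᵇ i
  ... | true = refl
  ... | false = erase-∈ i∈

  erase-∉ : ∀ {A i} → i ∉ A → erase A i ≡ i
  erase-∉ {A} {i} i∉ with any (λ a → does (a ≟ i)) A in eq
  ... | true = ⊥-elim (i∉ (any≡true⇒∈ A i eq))
  ... | false = refl

  erase-0 : ∀ A → erase A 0 ≡ 0
  erase-0 A with any (λ a → does (a ≟ 0)) A
  ... | true = refl
  ... | false = refl

  erase-ext : ∀ {A A' i} → (i ∈ A → i ∈ A') → (i ∈ A' → i ∈ A) → erase A i ≡ erase A' i
  erase-ext {A} {A'} {i} to from with i ∈? A
  ... | yes i∈ = trans (erase-∈ i∈) (sym (erase-∈ (to i∈)))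
  ... | no i∉ = trans (erase-∉ i∉) (sym (erase-∉ (λ i∈' → i∉ (from i∈'))))

  /-ext : ∀ w {A A'} → (∀ {m} → m ∈ A → m ∈ A') → (∀ {m} → m ∈ A' → m ∈ A) → w / A ≡ w / A'
  /-ext w to from = map-cong-∈ w (λ _ → erase-ext to from)

  /-[] : ∀ w → w / [] ≡ w
  /-[] w = map-id w

  letters-/ : ∀ {A w} → LettersIn (w / A) w
  letters-/ {A} m∈ with ∈-map⁻ (erase A) m∈
  ... | i , i∈ , refl with i ∈? A
  ... | yes i∈A = inj₁ (erase-∈ i∈A)
  ... | no i∉A rewrite erase-∉ i∉A = inj₂ i∈

  relabel-/ : ∀ {ψ z} A B → OrderPreserving ψ z → LettersIn A z → LettersIn B z → map ψ B / map ψ A ≡ map ψ (B / A)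
  relabel-/ {ψ} A B op A⊆z B⊆z = trans (sym (map-∘ B)) (trans (map-cong-∈ B commutes) (map-∘ B))
    where
    commutes : ∀ {i} → i ∈ B → erase (map ψ A) (ψ i) ≡ ψ (erase A i)
    commutes {i} i∈ with i ∈? A
    ... | yes i∈A rewrite erase-∈ i∈A = trans (erase-∈ (∈-map⁺ ψ i∈A)) (sym (proj₁ op))
    ... | no i∉A rewrite erase-∉ i∉A = erase-∉ λ ψi∈ → let (a , a∈ , eq) = ∈-map⁻ ψ ψi∈ in
            i∉A (subst (_∈ A) (sym (OrderPreserving-injective op (B⊆z i∈) (A⊆z a∈) eq)) a∈)

  /-/ : ∀ C A B → (C / A) / (B / A) ≡ C / (A ++ B)
  /-/ C A B = trans (sym (map-∘ C)) (map-cong-∈ C (λ {i} _ → stages i))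
    where
    stages : ∀ i → erase (B / A) (erase A i) ≡ erase (A ++ B) i
    stages zero rewrite erase-0 A = trans (erase-0 (B / A)) (sym (erase-0 (A ++ B)))
    stages (suc i) with suc i ∈? A
    ... | yes i∈A rewrite erase-∈ i∈A = trans (erase-0 (B / A)) (sym (erase-∈ (∈-++⁺ˡ i∈A)))
    ... | no i∉A rewrite erase-∉ i∉A with suc i ∈? B
    ... | yes i∈B = trans (erase-∈ (subst (_∈ B / A) (erase-∉ i∉A) (∈-map⁺ (erase A) i∈B))) (sym (erase-∈ (∈-++⁺ʳ A i∈B)))
    ... | no i∉B = trans (erase-∉ i∉B/A) (sym (erase-∉ λ i∈ → [ i∉A , i∉B ]′ (∈-++⁻ A i∈)))
      where
      i∉B/A : suc i ∉ B / A
      i∉B/A i∈ with ∈-map⁻ (erase A) i∈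
      ... | b , b∈ , eq with b ∈? A
      ... | yes b∈A rewrite erase-∈ b∈A = ⊥-elim (1+n≢0 eq)
      ... | no b∉A rewrite erase-∉ b∉A = i∉B (subst (_∈ B) (sym eq) b∈)

  shift : ℕ → ℕ → ℕ
  shift k zero = zero
  shift k (suc n) = suc n + k

  T≡map-shift : ∀ k w → T k w ≡ map (shift k) w
  T≡map-shift k [] = refl
  T≡map-shift k (zero ∷ w) = cong (zero ∷_) (T≡map-shift k w)
  T≡map-shift k (suc x ∷ w) = cong (suc x + k ∷_) (T≡map-shift k w)

  shift-monotone : ∀ k {a b} → a ≤ b → shift k a ≤ shift k b
  shift-monotone k {zero} _ = z≤n
  shift-monotone k {suc a} {suc b} a≤b = +-monoˡ-≤ k a≤b

  shift-+ : ∀ a b n → shift (b + a) n ≡ shift a (shift b n)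
  shift-+ a b zero = refl
  shift-+ a b (suc n) = sym (+-assoc (suc n) b a)

  shift-0 : ∀ n → shift 0 n ≡ n
  shift-0 zero = refl
  shift-0 (suc n) = +-identityʳ (suc n)

  shift-large : ∀ k {j} → j ≢ 0 → k < shift k j
  shift-large k {zero} j≢0 = ⊥-elim (j≢0 refl)
  shift-large k {suc j} _ = s≤s (m≤n+m k j)

  shift-injective : ∀ k {a b} → shift k a ≡ shift k b → a ≡ b
  shift-injective k {zero} {zero} _ = refl
  shift-injective k {suc a} {suc b} eq = +-cancelʳ-≡ k (suc a) (suc b) eq

  sup-∈ : ∀ {m w} → m ∈ w → m ≤ sup w
  sup-∈ {m} {x ∷ w} (here refl) = m≤m⊔n m (sup w)
  sup-∈ {m} {x ∷ w} (there m∈) = ≤-trans (sup-∈ m∈) (m≤n⊔m x (sup w))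

  sup-map : ∀ {f} w → (∀ {a b} → a ≤ b → f a ≤ f b) → f 0 ≡ 0 → sup (map f w) ≡ f (sup w)
  sup-map [] _ f0 = sym f0
  sup-map {f} (x ∷ w) mono f0 = trans (cong (f x ⊔_) (sup-map w mono f0)) (sym (mono-≤-distrib-⊔ mono x (sup w)))

  sup-++ : ∀ u v → sup (u ++ v) ≡ sup u ⊔ sup v
  sup-++ [] v = refl
  sup-++ (x ∷ u) v = trans (cong (x ⊔_) (sup-++ u v)) (sym (⊔-assoc x (sup u) (sup v)))

  sup-⋆ : ∀ u v → sup (u ⋆ v) ≡ sup v + sup u
  sup-⋆ u v rewrite sup-++ u (T (sup u) v) | T≡map-shift (sup u) v
                  | sup-map {shift (sup u)} v (shift-monotone (sup u)) refl with sup v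
  ... | zero = ⊔-identityʳ (sup u)
  ... | suc s = m≤n⇒m⊔n≡n (m≤n+m (sup u) (suc s))

  ⋆-assoc : ∀ u v w → (u ⋆ v) ⋆ w ≡ u ⋆ (v ⋆ w)
  ⋆-assoc u v w rewrite sup-⋆ u v | T≡map-shift (sup v + sup u) w | T≡map-shift (sup u) (v ++ T (sup v) w)
                      | T≡map-shift (sup u) v | T≡map-shift (sup v) w
                      | map-++ (shift (sup u)) v (map (shift (sup v)) w)
                      | ++-assoc u (map (shift (sup u)) v) (map (shift (sup v + sup u)) w)
    = cong (λ z → u ++ map (shift (sup u)) v ++ z)
           (trans (map-cong-∈ w (λ {n} _ → shift-+ (sup u) (sup v) n)) (map-∘ w))

  ⋆-identityˡ : ∀ v → [] ⋆ v ≡ v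
  ⋆-identityˡ v = trans (T≡map-shift 0 v) (trans (map-cong-∈ v (λ {n} _ → shift-0 n)) (map-id v))

  ⋆-identityʳ : ∀ u → u ⋆ [] ≡ u
  ⋆-identityʳ u = ++-identityʳ u

  _≤*_ : Word → ℕ → Set
  a ≤* k = ∀ {m} → m ∈ a → m ≤ k

  φ-++-prefix : ∀ k a b → a ≤* k → ∀ {i} → i ∈ a → φ (a ++ map (shift k) b) i ≡ φ a i
  φ-++-prefix k a b a≤k {i} i∈ =
    trans (φ-count (a ++ map (shift k) b) i (below a i) (below-unique a i)
            (λ m∈ → let (x , y , z) = ∈-below⁻ a i m∈ in ∈-++⁺ˡ x , y , z) complete)
          (sym (φ≡length-below a i))
    where
    complete : ∀ {m} → m ∈ a ++ map (shift k) b → m ≢ 0 → m ≤ i → m ∈ below a i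
    complete {m} m∈ m≢0 m≤i with ∈-++⁻ a m∈
    ... | inj₁ m∈a = ∈-below⁺ a i m∈a m≢0 m≤i
    ... | inj₂ m∈b with ∈-map⁻ (shift k) m∈b
    ... | zero , _ , refl = ⊥-elim (m≢0 refl)
    ... | suc m' , _ , refl = ⊥-elim (<⇒≱ (shift-large k {suc m'} (λ ())) (≤-trans m≤i (a≤k i∈)))

  sup-pack : ∀ k a → a ≤* k → sup (pack a) ≡ φ a k
  sup-pack k a a≤k = trans (sup-map a (φ-monotone a) refl)
    (trans (φ≡length-below a (sup a)) (sym (φ-count a k (below a (sup a)) (below-unique a _)
      (λ m∈ → let (x , y , _) = ∈-below⁻ a (sup a) m∈ in x , y , a≤k x)
      (λ x y _ → ∈-below⁺ a (sup a) x y (sup-∈ x)))))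

  φ-++-suffix : ∀ k a b → a ≤* k → ∀ {j} → j ∈ b → φ (a ++ map (shift k) b) (shift k j) ≡ shift (φ a k) (φ b j)
  φ-++-suffix k a b a≤k {zero} _ = refl
  φ-++-suffix k a b a≤k {suc j} j∈ with φ-positive b j∈ (λ ())
  ... | t , φbj≡ rewrite φbj≡ =
    trans (φ-count c (suc j + k) (map (shift k) (below b (suc j)) ++ below a k)
            (Unique.++⁺ (unique-map (λ x∈ y∈ → shift-injective k) (below-unique b _)) (below-unique a k) disjoint)
            sound complete)
      (trans (length-++ (map (shift k) (below b (suc j))))
        (cong₂ _+_ (trans (length-map (shift k) (below b (suc j))) (trans (sym (φ≡length-below b (suc j))) φbj≡))
                   (sym (φ≡length-below a k))))
    where
    c : Word
    c = a ++ map (shift k) b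
    disjoint : ∀ {v} → ¬ (v ∈ map (shift k) (below b (suc j)) × v ∈ below a k)
    disjoint (p , q) with ∈-map⁻ (shift k) p
    ... | m' , m'∈ , refl = <⇒≱ (shift-large k (proj₁ (proj₂ (∈-below⁻ b _ m'∈)))) (proj₂ (proj₂ (∈-below⁻ a k q)))
    sound : ∀ {m} → m ∈ map (shift k) (below b (suc j)) ++ below a k → m ∈ c × m ≢ 0 × m ≤ suc j + k
    sound m∈ with ∈-++⁻ (map (shift k) (below b (suc j))) m∈
    ... | inj₂ q = let (x , y , z) = ∈-below⁻ a k q in ∈-++⁺ˡ x , y , ≤-trans z (m≤n+m k (suc j))
    ... | inj₁ p with ∈-map⁻ (shift k) p
    ... | zero , m'∈ , refl = ⊥-elim (proj₁ (proj₂ (∈-below⁻ b _ m'∈)) refl)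
    ... | suc m' , m'∈ , refl = ∈-++⁺ʳ a (∈-map⁺ (shift k) (proj₁ (∈-below⁻ b _ m'∈))) , (λ ()) ,
          +-monoˡ-≤ k (proj₂ (proj₂ (∈-below⁻ b _ m'∈)))
    complete : ∀ {m} → m ∈ c → m ≢ 0 → m ≤ suc j + k → m ∈ map (shift k) (below b (suc j)) ++ below a k
    complete m∈ m≢0 m≤ with ∈-++⁻ a m∈
    ... | inj₁ p = ∈-++⁺ʳ (map (shift k) (below b (suc j))) (∈-below⁺ a k p m≢0 (a≤k p))
    ... | inj₂ p with ∈-map⁻ (shift k) p
    ... | zero , _ , refl = ⊥-elim (m≢0 refl)
    ... | suc m' , m'∈ , refl = ∈-++⁺ˡ (∈-map⁺ (shift k) (∈-below⁺ b (suc j) m'∈ (λ ()) (+-cancelʳ-≤ k (suc m') (suc j) m≤)))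

  pack-shift : ∀ k a b → a ≤* k → pack (a ++ T k b) ≡ pack a ⋆ pack b
  pack-shift k a b a≤k rewrite T≡map-shift k b | T≡map-shift (sup (pack a)) (pack b) =
    trans (map-++ (φ (a ++ map (shift k) b)) a (map (shift k) b))
      (cong₂ _++_ (map-cong-∈ a (φ-++-prefix k a b a≤k))
        (trans (sym (map-∘ b)) (trans (map-cong-∈ b suffix) (map-∘ b))))
    where
    suffix : ∀ {j} → j ∈ b → φ (a ++ map (shift k) b) (shift k j) ≡ shift (sup (pack a)) (φ b j)
    suffix j∈ rewrite sup-pack k a a≤k = φ-++-suffix k a b a≤k j∈

  Packed-⋆ : ∀ u v → Packed u → Packed v → Packed (u ⋆ v)
  Packed-⋆ u v pu pv = trans (pack-shift (sup u) u v sup-∈) (cong₂ _⋆_ pu pv)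

  data Interleaving : Word → Word → Word → Set where
    nil   : Interleaving [] [] []
    left  : ∀ {x w a b} → Interleaving w a b → Interleaving (x ∷ w) (x ∷ a) b
    right : ∀ {x w a b} → Interleaving w a b → Interleaving (x ∷ w) a (x ∷ b)

  extendSplit : ℕ → Word × Word → List (Word × Word)
  extendSplit x p = (x ∷ proj₁ p , proj₂ p) ∷ (proj₁ p , x ∷ proj₂ p) ∷ []

  splits-interleaving : ∀ w {p} → p ∈ splits w → Interleaving w (proj₁ p) (proj₂ p)
  splits-interleaving [] (here refl) = nil
  splits-interleaving (x ∷ w) p∈ with find (∈-concatMap⁻ (extendSplit x) {xs = splits w} p∈)
  ... | q , q∈ , here refl = left (splits-interleaving w q∈)
  ... | q , q∈ , there (here refl) = right (splits-interleaving w q∈)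

  ⊆-left : ∀ {w a b} → Interleaving w a b → ∀ {m} → m ∈ a → m ∈ w
  ⊆-left (left il) (here refl) = here refl
  ⊆-left (left il) (there m∈) = there (⊆-left il m∈)
  ⊆-left (right il) m∈ = there (⊆-left il m∈)

  ⊆-right : ∀ {w a b} → Interleaving w a b → ∀ {m} → m ∈ b → m ∈ w
  ⊆-right (right il) (here refl) = here refl
  ⊆-right (right il) (there m∈) = there (⊆-right il m∈)
  ⊆-right (left il) m∈ = there (⊆-right il m∈)

  ⊆-left++right : ∀ {w a b} → Interleaving w a b → ∀ {m} → m ∈ w → m ∈ a ⊎ m ∈ b
  ⊆-left++right (left il) (here refl) = inj₁ (here refl)
  ⊆-left++right (right il) (here refl) = inj₂ (here refl)
  ⊆-left++right (left il) (there m∈) with ⊆-left++right il m∈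
  ... | inj₁ q = inj₁ (there q)
  ... | inj₂ q = inj₂ q
  ⊆-left++right (right il) (there m∈) with ⊆-left++right il m∈
  ... | inj₁ q = inj₁ q
  ... | inj₂ q = inj₂ (there q)

  interleaving-length : ∀ {w a b} → Interleaving w a b → length a + length b ≡ length w
  interleaving-length nil = refl
  interleaving-length (left il) = cong suc (interleaving-length il)
  interleaving-length (right {a = a} il) = trans (+-suc (length a) _) (cong suc (interleaving-length il))

  mapPair : (ℕ → ℕ) → Word × Word → Word × Word
  mapPair f p = map f (proj₁ p) , map f (proj₂ p)

  splits-map : ∀ f w → splits (map f w) ≡ map (mapPair f) (splits w)
  splits-map f [] = refl
  splits-map f (x ∷ w) rewrite splits-map f w =
    trans (concatMap-map _ (mapPair f) (splits w)) (sym (map-concatMap (mapPair f) _ (splits w)))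

  rightEmpty leftEmpty : Word × Word → Bool
  rightEmpty p = null (proj₂ p)
  leftEmpty p = null (proj₁ p)

  -- among the two extensions of each splitting exactly one keeps the chosen side empty
  filter-rightEmpty-extend : ∀ x l → filterᵇ rightEmpty (concatMap (extendSplit x) l)
                                  ≡ map (λ q → (x ∷ proj₁ q , proj₂ q)) (filterᵇ rightEmpty l)
  filter-rightEmpty-extend x [] = refl
  filter-rightEmpty-extend x ((a , []) ∷ l) = cong ((x ∷ a , []) ∷_) (filter-rightEmpty-extend x l)
  filter-rightEmpty-extend x ((a , y ∷ b) ∷ l) = filter-rightEmpty-extend x l

  filter-leftEmpty-extend : ∀ x l → filterᵇ leftEmpty (concatMap (extendSplit x) l)
                                 ≡ map (λ q → (proj₁ q , x ∷ proj₂ q)) (filterᵇ leftEmpty l)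
  filter-leftEmpty-extend x [] = refl
  filter-leftEmpty-extend x (([] , b) ∷ l) = cong (([] , x ∷ b) ∷_) (filter-leftEmpty-extend x l)
  filter-leftEmpty-extend x ((y ∷ a , b) ∷ l) = filter-leftEmpty-extend x l

  splits-rightEmpty : ∀ w → filterᵇ rightEmpty (splits w) ≡ (w , []) ∷ []
  splits-rightEmpty [] = refl
  splits-rightEmpty (x ∷ w) = trans (filter-rightEmpty-extend x (splits w)) (cong (map _) (splits-rightEmpty w))

  splits-leftEmpty : ∀ w → filterᵇ leftEmpty (splits w) ≡ ([] , w) ∷ []
  splits-leftEmpty [] = refl
  splits-leftEmpty (x ∷ w) = trans (filter-leftEmpty-extend x (splits w)) (cong (map _) (splits-leftEmpty w))

  coterm : Word × Word → Word × Word
  coterm p = pack (proj₁ p) , pack (proj₂ p / proj₁ p)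

  -- The term of the iterated coproduct attached to a three-part splitting
  -- (A, B, C) of a word.
  triple : Word → Word → Word → Word × Word × Word
  triple A B C = pack A , pack (B / A) , pack (C / (A ++ B))

  -- Splitting the left factor A₀ = A ⋈ B of a splitting (A₀, C), read
  -- through the relabelling pack A₀ = map (φ A₀) A₀, gives  triple A B C.
  split-left-factor : ∀ {A₀ A B} C → Interleaving A₀ A B →
    (proj₁ (coterm (mapPair (φ A₀) (A , B))) , proj₂ (coterm (mapPair (φ A₀) (A , B))) , pack (C / A₀)) ≡ triple A B C
  split-left-factor {A₀} {A} {B} C il = cong₂ _,_ packA (cong₂ _,_ packB/A packC/A₀)
    where
    op : OrderPreserving (φ A₀) A₀
    op = φ-orderPreserving A₀
    A⊆A₀ : LettersIn A A₀
    A⊆A₀ m∈ = inj₂ (⊆-left il m∈)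
    B⊆A₀ : LettersIn B A₀
    B⊆A₀ m∈ = inj₂ (⊆-right il m∈)
    B/A⊆A₀ : LettersIn (B / A) A₀
    B/A⊆A₀ m∈ = [ inj₁ , B⊆A₀ ]′ (letters-/ {A} {B} m∈)
    packA : pack (map (φ A₀) A) ≡ pack A
    packA = pack-relabel A (OrderPreserving-⊆ op A⊆A₀)
    packB/A : pack (map (φ A₀) B / map (φ A₀) A) ≡ pack (B / A)
    packB/A = trans (cong pack (relabel-/ A B op A⊆A₀ B⊆A₀)) (pack-relabel (B / A) (OrderPreserving-⊆ op B/A⊆A₀))
    packC/A₀ : pack (C / A₀) ≡ pack (C / (A ++ B))
    packC/A₀ = cong pack (/-ext C (λ m∈ → [ ∈-++⁺ˡ , ∈-++⁺ʳ A ]′ (⊆-left++right il m∈))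
                                 (λ m∈ → [ ⊆-left il , ⊆-right il ]′ (∈-++⁻ A m∈)))

  -- Splitting the right factor C₀ = B ⋈ C of a splitting (A, C₀), read through
  -- the erasure of A and the relabelling pack (C₀ / A), also gives  triple A B C.
  split-right-factor : ∀ A {C₀ B C} → Interleaving C₀ B C →
    (pack A , coterm (mapPair (φ (C₀ / A)) (mapPair (erase A) (B , C)))) ≡ triple A B C
  split-right-factor A {C₀} {B} {C} il = cong (pack A ,_) (cong₂ _,_ packB/A packC/AB)
    where
    op : OrderPreserving (φ (C₀ / A)) (C₀ / A)
    op = φ-orderPreserving (C₀ / A)
    B/A⊆ : LettersIn (B / A) (C₀ / A)
    B/A⊆ m∈ = inj₂ (map⁺ (erase A) (⊆-left il) m∈)
    C/A⊆ : LettersIn (C / A) (C₀ / A)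
    C/A⊆ m∈ = inj₂ (map⁺ (erase A) (⊆-right il) m∈)
    C/A/B/A⊆ : LettersIn ((C / A) / (B / A)) (C₀ / A)
    C/A/B/A⊆ m∈ = [ inj₁ , C/A⊆ ]′ (letters-/ {B / A} {C / A} m∈)
    packB/A : pack (map (φ (C₀ / A)) (B / A)) ≡ pack (B / A)
    packB/A = pack-relabel (B / A) (OrderPreserving-⊆ op B/A⊆)
    packC/AB : pack (map (φ (C₀ / A)) (C / A) / map (φ (C₀ / A)) (B / A)) ≡ pack (C / (A ++ B))
    packC/AB = trans (cong pack (relabel-/ (B / A) (C / A) op B/A⊆ C/A⊆))
                 (trans (pack-relabel ((C / A) / (B / A)) (OrderPreserving-⊆ op C/A/B/A⊆))
                   (cong pack (/-/ C A B)))

  /-shift : ∀ k p₁ p₂ q₁ q₂ → p₁ ≤* k → p₂ ≤* k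
    → (p₂ ++ map (shift k) q₂) / (p₁ ++ map (shift k) q₁) ≡ (p₂ / p₁) ++ map (shift k) (q₂ / q₁)
  /-shift k p₁ p₂ q₁ q₂ p₁≤k p₂≤k =
    trans (map-++ _ p₂ (map (shift k) q₂))
      (cong₂ _++_ (map-cong-∈ p₂ prefix) (trans (sym (map-∘ q₂)) (trans (map-cong-∈ q₂ (λ {j} _ → suffix j)) (map-∘ q₂))))
    where
    prefix : ∀ {i} → i ∈ p₂ → erase (p₁ ++ map (shift k) q₁) i ≡ erase p₁ i
    prefix {zero} _ = trans (erase-0 (p₁ ++ map (shift k) q₁)) (sym (erase-0 p₁))
    prefix {suc i} i∈ = erase-ext (λ m∈ → [ (λ m∈p₁ → m∈p₁) , (λ m∈q → ⊥-elim (not-shifted m∈q)) ]′ (∈-++⁻ p₁ m∈)) ∈-++⁺ˡ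
      where
      not-shifted : suc i ∉ map (shift k) q₁
      not-shifted m∈ with ∈-map⁻ (shift k) m∈
      ... | suc j , _ , eq = <⇒≱ (subst (k <_) (sym eq) (shift-large k {suc j} (λ ()))) (p₂≤k i∈)
    suffix : ∀ j → erase (p₁ ++ map (shift k) q₁) (shift k j) ≡ shift k (erase q₁ j)
    suffix zero = trans (erase-0 (p₁ ++ map (shift k) q₁)) (cong (shift k) (sym (erase-0 q₁)))
    suffix (suc j) with suc j ∈? q₁
    ... | yes j∈ rewrite erase-∈ j∈ = erase-∈ (∈-++⁺ʳ p₁ (∈-map⁺ (shift k) j∈))
    ... | no j∉ rewrite erase-∉ j∉ = erase-∉ λ m∈ → [ (λ q → <⇒≱ (shift-large k {suc j} (λ ())) (p₁≤k q)) ,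
          (λ q → let (a , a∈ , eq) = ∈-map⁻ (shift k) q in j∉ (subst (_∈ q₁) (sym (shift-injective k eq)) a∈)) ]′ (∈-++⁻ p₁ m∈)

  coterm-shift : ∀ k p q → proj₁ p ≤* k → proj₂ p ≤* k →
    coterm (proj₁ p ++ map (shift k) (proj₁ q) , proj₂ p ++ map (shift k) (proj₂ q)) ≡
    (proj₁ (coterm p) ⋆ proj₁ (coterm q) , proj₂ (coterm p) ⋆ proj₂ (coterm q))
  coterm-shift k (p₁ , p₂) (q₁ , q₂) p₁≤k p₂≤k = cong₂ _,_
    (trans (cong (λ z → pack (p₁ ++ z)) (sym (T≡map-shift k q₁))) (pack-shift k p₁ q₁ p₁≤k))
    (trans (cong pack (/-shift k p₁ p₂ q₁ q₂ p₁≤k p₂≤k))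
      (trans (cong (λ z → pack (p₂ / p₁ ++ z)) (sym (T≡map-shift k (q₂ / q₁))))
        (pack-shift k (p₂ / p₁) (q₂ / q₁) p₂/p₁≤k)))
    where
    p₂/p₁≤k : (p₂ / p₁) ≤* k
    p₂/p₁≤k m∈ with letters-/ {p₁} {p₂} m∈
    ... | inj₁ refl = z≤n
    ... | inj₂ q = p₂≤k q

  Δw-rightEmpty : ∀ w → filterᵇ rightEmpty (Δw w) ≡ (pack w , []) ∷ []
  Δw-rightEmpty w = trans (filterᵇ-map rightEmpty coterm (splits w))
    (cong (map coterm) (trans (filterᵇ-cong (splits w) (λ r → trans (null-map _ (proj₂ r / proj₁ r)) (null-map _ (proj₂ r))))
                              (splits-rightEmpty w)))

  Δw-leftEmpty : ∀ w → filterᵇ leftEmpty (Δw w) ≡ ([] , pack (w / [])) ∷ []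
  Δw-leftEmpty w = trans (filterᵇ-map leftEmpty coterm (splits w))
    (cong (map coterm) (trans (filterᵇ-cong (splits w) (λ r → null-map _ (proj₁ r))) (splits-leftEmpty w)))

  -- The remaining terms have a strictly shorter left (resp. right) factor;
  -- this is what makes the recursive antipodes well founded.
  properˡ properʳ : Word → List (Word × Word)
  properˡ w = filterᵇ (not ∘ rightEmpty) (Δw w)
  properʳ w = filterᵇ (not ∘ leftEmpty) (Δw w)

  properˡ-shorter : ∀ w {p} → p ∈ properˡ w → suc (length (proj₁ p)) ≤ length w
  properˡ-shorter w {p} p∈ with ∈-filter⁻ (T? ∘ not ∘ rightEmpty) {xs = Δw w} p∈
  ... | p∈Δw , nonempty with ∈-map⁻ coterm p∈Δw
  ... | (r₁ , y ∷ r₂) , r∈ , refl =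
    subst (suc (length (pack r₁)) ≤_) (interleaving-length (splits-interleaving w r∈))
      (subst (λ n → suc n ≤ length r₁ + length (y ∷ r₂)) (sym (length-map (φ r₁) r₁))
        (subst (suc (length r₁) ≤_) (sym (+-suc (length r₁) (length r₂))) (s≤s (m≤m+n _ _))))
  ... | (r₁ , []) , r∈ , refl = ⊥-elim nonempty

  properʳ-shorter : ∀ w {p} → p ∈ properʳ w → suc (length (proj₂ p)) ≤ length w
  properʳ-shorter w {p} p∈ with ∈-filter⁻ (T? ∘ not ∘ leftEmpty) {xs = Δw w} p∈
  ... | p∈Δw , nonempty with ∈-map⁻ coterm p∈Δw
  ... | (y ∷ r₁ , r₂) , r∈ , refl =
    subst (suc (length (pack (r₂ / (y ∷ r₁)))) ≤_) (interleaving-length (splits-interleaving w r∈))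
      (subst (λ n → suc n ≤ suc (length r₁) + length r₂) (sym (trans (length-map _ (r₂ / (y ∷ r₁))) (length-map _ r₂)))
        (s≤s (m≤n+m _ _)))
  ... | ([] , r₂) , r∈ , refl = ⊥-elim nonempty

module Hopf {c ℓ : Level} (k : Field c ℓ) where

  open Field k
  open FreeModule k
  open Words
  open import Data.Nat using (ℕ; zero; suc; _≤_; s≤s)
  open import Data.Nat.Properties using (≤-trans; ≤-pred; ≤-refl)
  open import Data.List using (List; []; _∷_; map; length; _++_; concatMap; deduplicate; foldr; filterᵇ)
  open import Data.List.Membership.Propositional using (_∈_)
  open import Data.List.Membership.Propositional.Properties using (∈-filter⁻; ∈-deduplicate⁺; ∈-++⁺ˡ; ∈-++⁺ʳ)
  open import Data.List.Relation.Unary.Any using (here; there)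
  open import Data.List.Relation.Unary.All as All using (All; []; _∷_)
  import Data.List.Relation.Unary.All.Properties as AllP
  open import Data.List.Relation.Unary.AllPairs using (_∷_)
  open import Data.List.Relation.Unary.Unique.Propositional using (Unique)
  import Data.List.Relation.Unary.Unique.DecPropositional.Properties as UniqueDec
  open import Data.Product using (_×_; _,_; proj₁; proj₂)
  open import Data.Bool using (Bool; true; false; not)
  open import Data.Empty using (⊥-elim)
  open import Function using (_∘_)
  import Relation.Binary.PropositionalEquality as P
  open P using (_≡_)
  open import Relation.Binary.Definitions using (DecidableEquality)
  open import Relation.Nullary using (yes; no)
  open import Relation.Nullary.Decidable using (T?)
  open import Relation.Binary.Reasoning.Setoid setoid
  open import Algebra.Properties.CommutativeSemigroup +-commutativeSemigroup using (interchange)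
  open import Algebra.Properties.Ring ring using (-1*x≈-x)

  ∑ : ∀ {a} {A : Set a} → List A → (A → Carrier) → Carrier
  ∑ l F = foldr (λ x s → F x + s) 0# l

  private variable
    a₁ a₂ : Level
    A : Set a₁
    A' : Set a₂

  ∑-cong : ∀ (l : List A) {F G} → (∀ x → F x ≈ G x) → ∑ l F ≈ ∑ l G
  ∑-cong [] h = refl
  ∑-cong (x ∷ l) h = +-cong (h x) (∑-cong l h)

  ∑-cong-∈ : ∀ (l : List A) {F G} → (∀ {x} → x ∈ l → F x ≈ G x) → ∑ l F ≈ ∑ l G
  ∑-cong-∈ [] h = refl
  ∑-cong-∈ (x ∷ l) h = +-cong (h (here P.refl)) (∑-cong-∈ l (λ m → h (there m)))

  ∑-++ : ∀ (l m : List A) F → ∑ (l ++ m) F ≈ ∑ l F + ∑ m F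
  ∑-++ [] m F = sym (+-identityˡ _)
  ∑-++ (x ∷ l) m F = trans (+-cong refl (∑-++ l m F)) (sym (+-assoc _ _ _))

  ∑-+ : ∀ (l : List A) F G → ∑ l (λ x → F x + G x) ≈ ∑ l F + ∑ l G
  ∑-+ [] F G = sym (+-identityˡ _)
  ∑-+ (x ∷ l) F G = trans (+-cong refl (∑-+ l F G)) (interchange _ _ _ _)

  ∑-* : ∀ (l : List A) a F → ∑ l (λ x → a * F x) ≈ a * ∑ l F
  ∑-* [] a F = sym (zeroʳ a)
  ∑-* (x ∷ l) a F = trans (+-cong refl (∑-* l a F)) (sym (distribˡ a _ _))

  ∑-0 : ∀ (l : List A) → ∑ l (λ _ → 0#) ≈ 0#
  ∑-0 [] = refl
  ∑-0 (x ∷ l) = trans (+-identityˡ _) (∑-0 l)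

  ∑-map : ∀ (f : A' → A) (l : List A') F → ∑ (map f l) F ≡ ∑ l (F ∘ f)
  ∑-map f [] F = P.refl
  ∑-map f (x ∷ l) F = P.cong (F (f x) +_) (∑-map f l F)

  ∑-concatMap : ∀ (f : A' → List A) (l : List A') F → ∑ (concatMap f l) F ≈ ∑ l (λ b → ∑ (f b) F)
  ∑-concatMap f [] F = refl
  ∑-concatMap f (x ∷ l) F = trans (∑-++ (f x) (concatMap f l) F) (+-cong refl (∑-concatMap f l F))

  ∑-swap : ∀ (l : List A) (m : List A') (F : A → A' → Carrier) → ∑ l (λ x → ∑ m (F x)) ≈ ∑ m (λ y → ∑ l (λ x → F x y))
  ∑-swap [] m F = sym (∑-0 m)
  ∑-swap (x ∷ l) m F = trans (+-cong refl (∑-swap l m F)) (sym (∑-+ m (F x) (λ y → ∑ l (λ x → F x y))))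

  ∑-filter : ∀ {A : Set} (test : A → Bool) l (F : A → Carrier) → ∑ l F ≈ ∑ (filterᵇ test l) F + ∑ (filterᵇ (not ∘ test) l) F
  ∑-filter test [] F = sym (+-identityʳ _)
  ∑-filter test (x ∷ l) F with test x
  ... | true = trans (+-cong refl (∑-filter test l F)) (sym (+-assoc _ _ _))
  ... | false = trans (+-cong refl (∑-filter test l F))
                  (trans (sym (+-assoc _ _ _)) (trans (+-cong (+-comm _ _) refl) (+-assoc _ _ _)))

  ⟦_⟧ : {B : Set} → Lin B → (B → Carrier) → Carrier
  ⟦ x ⟧ g = ∑ x (λ p → proj₁ p * g (proj₂ p))

  module _ {B : Set} where

    ⟦⟧-cong : ∀ (x : Lin B) {g h} → (∀ b → g b ≈ h b) → ⟦ x ⟧ g ≈ ⟦ x ⟧ h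
    ⟦⟧-cong x h = ∑-cong x (λ p → *-cong refl (h (proj₂ p)))

    ⟦⟧-cong-All : ∀ (x : Lin B) {g h} → All (λ p → g (proj₂ p) ≈ h (proj₂ p)) x → ⟦ x ⟧ g ≈ ⟦ x ⟧ h
    ⟦⟧-cong-All [] [] = refl
    ⟦⟧-cong-All (p ∷ x) (q ∷ qs) = +-cong (*-cong refl q) (⟦⟧-cong-All x qs)

    ⟦⟧-++ : ∀ (x y : Lin B) g → ⟦ x ++ y ⟧ g ≈ ⟦ x ⟧ g + ⟦ y ⟧ g
    ⟦⟧-++ x y g = ∑-++ x y _

    ⟦⟧-scale : ∀ a (x : Lin B) g → ⟦ scale a x ⟧ g ≈ a * ⟦ x ⟧ g
    ⟦⟧-scale a x g = trans (reflexive (∑-map _ x _)) (trans (∑-cong x (λ p → *-assoc a (proj₁ p) _)) (∑-* x a _))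

    ⟦⟧-+ : ∀ (x : Lin B) g h → ⟦ x ⟧ (λ b → g b + h b) ≈ ⟦ x ⟧ g + ⟦ x ⟧ h
    ⟦⟧-+ x g h = trans (∑-cong x (λ p → distribˡ (proj₁ p) _ _)) (∑-+ x _ _)

    ⟦⟧-* : ∀ (x : Lin B) a g → ⟦ x ⟧ (λ b → a * g b) ≈ a * ⟦ x ⟧ g
    ⟦⟧-* x a g = trans (∑-cong x (λ p → trans (sym (*-assoc _ _ _)) (trans (*-cong (*-comm _ a) refl) (*-assoc _ _ _)))) (∑-* x a _)

    ⟦⟧-0 : ∀ (x : Lin B) → ⟦ x ⟧ (λ _ → 0#) ≈ 0#
    ⟦⟧-0 x = trans (∑-cong x (λ p → zeroʳ _)) (∑-0 x)

    ⟦⟧-∑ : ∀ (x : Lin B) (l : List A) (F : B → A → Carrier) → ⟦ x ⟧ (λ b → ∑ l (F b)) ≈ ∑ l (λ a → ⟦ x ⟧ (λ b → F b a))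
    ⟦⟧-∑ x l F = trans (∑-cong x (λ p → sym (∑-* l (proj₁ p) _))) (∑-swap x l (λ p a → proj₁ p * F (proj₂ p) a))

    ⟦⟧-single : ∀ a (b : B) g → ⟦ (a , b) ∷ [] ⟧ g ≈ a * g b
    ⟦⟧-single a b g = +-identityʳ _

    ⟦⟧-basis : ∀ (b : B) g → ⟦ (1# , b) ∷ [] ⟧ g ≈ g b
    ⟦⟧-basis b g = trans (+-identityʳ _) (*-identityˡ _)

    ⟦⟧-ones : ∀ (l : List B) g → ⟦ map (λ p → 1# , p) l ⟧ g ≈ ∑ l g
    ⟦⟧-ones l g = trans (reflexive (∑-map _ l _)) (∑-cong l (λ p → *-identityˡ _))

  ⟦⟧-extend : ∀ {B C : Set} (f : B → Lin C) (x : Lin B) g → ⟦ extend f x ⟧ g ≈ ⟦ x ⟧ (λ b → ⟦ f b ⟧ g)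
  ⟦⟧-extend f x g = trans (∑-concatMap _ x _) (∑-cong x (λ p → ⟦⟧-scale (proj₁ p) (f (proj₂ p)) g))

  -- Coefficientwise equality is equality of all evaluations: the coefficient
  -- of b is the evaluation against the indicator δ b, and conversely an
  -- evaluation is Σ_b coeff(b)·g(b) over the (finitely many) basis elements
  -- occurring.

  module ByEvaluation {B : Set} (_≟_ : DecidableEquality B) where

    δ : B → B → Carrier
    δ b b' with b' ≟ b
    ... | yes _ = 1#
    ... | no _ = 0#

    coeff≈⟦δ⟧ : ∀ (x : Lin B) b → coeff _≟_ x b ≈ ⟦ x ⟧ (δ b)
    coeff≈⟦δ⟧ [] b = refl
    coeff≈⟦δ⟧ ((a , b') ∷ x) b with b' ≟ b
    ... | yes _ = +-cong (sym (*-identityʳ a)) (coeff≈⟦δ⟧ x b)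
    ... | no _ = trans (sym (+-identityˡ _)) (+-cong (sym (zeroʳ a)) (coeff≈⟦δ⟧ x b))

    term : Carrier → B → (B → Carrier) → B → Carrier
    term a b' g b with b' ≟ b
    ... | yes _ = a * g b
    ... | no _ = 0#

    ∑-term : ∀ (K : List B) a b' g → Unique K → b' ∈ K → ∑ K (term a b' g) ≈ a * g b'
    ∑-term (b ∷ K) a b' g (b∉K ∷ u) (here P.refl) with b' ≟ b'
    ... | no b'≢b' = ⊥-elim (b'≢b' P.refl)
    ... | yes _ = trans (+-cong refl (trans (∑-cong-∈ K vanish) (∑-0 K))) (+-identityʳ _)
      where
      vanish : ∀ {x} → x ∈ K → term a b' g x ≈ 0#
      vanish {x} x∈ with b' ≟ x
      ... | yes b'≡x = ⊥-elim (All.lookup b∉K x∈ b'≡x)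
      ... | no _ = refl
    ∑-term (b ∷ K) a b' g (b∉K ∷ u) (there b'∈) with b' ≟ b
    ... | yes P.refl = ⊥-elim (All.lookup b∉K b'∈ P.refl)
    ... | no _ = trans (+-identityˡ _) (∑-term K a b' g u b'∈)

    ⟦⟧≈∑coeff : ∀ (x : Lin B) (K : List B) g → Unique K → (∀ {b} → b ∈ map proj₂ x → b ∈ K)
              → ⟦ x ⟧ g ≈ ∑ K (λ b → coeff _≟_ x b * g b)
    ⟦⟧≈∑coeff [] K g u sub = sym (trans (∑-cong K (λ b → zeroˡ (g b))) (∑-0 K))
    ⟦⟧≈∑coeff ((a , b') ∷ x) K g u sub = begin
      a * g b' + ⟦ x ⟧ g ≈⟨ +-cong (sym (∑-term K a b' g u (sub (here P.refl)))) (⟦⟧≈∑coeff x K g u (λ m → sub (there m))) ⟩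
      ∑ K (term a b' g) + ∑ K (λ b → coeff _≟_ x b * g b) ≈⟨ sym (∑-+ K _ _) ⟩
      ∑ K (λ b → term a b' g b + coeff _≟_ x b * g b) ≈⟨ ∑-cong K collect ⟩
      ∑ K (λ b → coeff _≟_ ((a , b') ∷ x) b * g b) ∎
      where
      collect : ∀ b → term a b' g b + coeff _≟_ x b * g b ≈ coeff _≟_ ((a , b') ∷ x) b * g b
      collect b with b' ≟ b
      ... | yes _ = sym (distribʳ (g b) a _)
      ... | no _ = +-identityˡ _

    Eq⇒⟦⟧ : ∀ (x y : Lin B) → Eq _≟_ x y → ∀ g → ⟦ x ⟧ g ≈ ⟦ y ⟧ g
    Eq⇒⟦⟧ x y x≡y g = begin
      ⟦ x ⟧ g ≈⟨ ⟦⟧≈∑coeff x K g uniqueK (λ m → ∈-deduplicate⁺ _≟_ (∈-++⁺ˡ m)) ⟩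
      ∑ K (λ b → coeff _≟_ x b * g b) ≈⟨ ∑-cong K (λ b → *-cong (x≡y b) refl) ⟩
      ∑ K (λ b → coeff _≟_ y b * g b) ≈⟨ sym (⟦⟧≈∑coeff y K g uniqueK (λ m → ∈-deduplicate⁺ _≟_ (∈-++⁺ʳ (map proj₂ x) m))) ⟩
      ⟦ y ⟧ g ∎
      where
      K : List B
      K = deduplicate _≟_ (map proj₂ x ++ map proj₂ y)
      uniqueK : Unique K
      uniqueK = UniqueDec.deduplicate-! _≟_ (map proj₂ x ++ map proj₂ y)

    ⟦⟧⇒Eq : ∀ (x y : Lin B) → (∀ g → ⟦ x ⟧ g ≈ ⟦ y ⟧ g) → Eq _≟_ x y
    ⟦⟧⇒Eq x y h b = trans (coeff≈⟦δ⟧ x b) (trans (h (δ b)) (sym (coeff≈⟦δ⟧ y b)))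

  module E₁ = ByEvaluation _≟W_
  module E₂ = ByEvaluation _≟2_
  module E₃ = ByEvaluation _≟3_

  ∑-splits-∷ : ∀ x w (F : Word × Word → Carrier) →
    ∑ (splits (x ∷ w)) F ≈ ∑ (splits w) (λ q → F (x ∷ proj₁ q , proj₂ q) + F (proj₁ q , x ∷ proj₂ q))
  ∑-splits-∷ x w F = trans (∑-concatMap (extendSplit x) (splits w) F) (∑-cong (splits w) (λ q → +-cong refl (+-identityʳ _)))

  ∑-splits-++ : ∀ u v (F : Word × Word → Carrier) → ∑ (splits (u ++ v)) F ≈
    ∑ (splits u) (λ p → ∑ (splits v) (λ q → F (proj₁ p ++ proj₁ q , proj₂ p ++ proj₂ q)))
  ∑-splits-++ [] v F = sym (+-identityʳ _)
  ∑-splits-++ (x ∷ u) v F = begin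
    ∑ (splits (x ∷ u ++ v)) F ≈⟨ ∑-splits-∷ x (u ++ v) F ⟩
    ∑ (splits (u ++ v)) (λ r → F (x ∷ proj₁ r , proj₂ r) + F (proj₁ r , x ∷ proj₂ r)) ≈⟨ ∑-splits-++ u v _ ⟩
    ∑ (splits u) (λ p → ∑ (splits v) (λ q → F (x ∷ proj₁ p ++ proj₁ q , proj₂ p ++ proj₂ q) + F (proj₁ p ++ proj₁ q , x ∷ proj₂ p ++ proj₂ q)))
      ≈⟨ ∑-cong (splits u) (λ p → ∑-+ (splits v) _ _) ⟩
    ∑ (splits u) (λ p → ∑ (splits v) (λ q → F (x ∷ proj₁ p ++ proj₁ q , proj₂ p ++ proj₂ q)) + ∑ (splits v) (λ q → F (proj₁ p ++ proj₁ q , x ∷ proj₂ p ++ proj₂ q)))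
      ≈⟨ sym (∑-splits-∷ x u _) ⟩
    ∑ (splits (x ∷ u)) (λ p → ∑ (splits v) (λ q → F (proj₁ p ++ proj₁ q , proj₂ p ++ proj₂ q))) ∎

  ∑-splits-map : ∀ f z (F : Word × Word → Carrier) → ∑ (splits (map f z)) F ≡ ∑ (splits z) (F ∘ mapPair f)
  ∑-splits-map f z F = P.trans (P.cong (λ l → ∑ l F) (splits-map f z)) (∑-map (mapPair f) (splits z) F)

  ∑-Δw : ∀ w (F : Word × Word → Carrier) → ∑ (Δw w) F ≡ ∑ (splits w) (F ∘ coterm)
  ∑-Δw w F = ∑-map coterm (splits w) F

  ∑-Δw-map : ∀ f z (F : Word × Word → Carrier) → ∑ (Δw (map f z)) F ≡ ∑ (splits z) (λ s → F (coterm (mapPair f s)))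
  ∑-Δw-map f z F = P.trans (∑-Δw (map f z) F) (∑-splits-map f z (F ∘ coterm))

  ∑-split-left ∑-split-right : Word → (Word → Word → Word → Carrier) → Carrier
  ∑-split-left w Φ = ∑ (splits w) (λ p → ∑ (splits (proj₁ p)) (λ q → Φ (proj₁ q) (proj₂ q) (proj₂ p)))
  ∑-split-right w Φ = ∑ (splits w) (λ p → ∑ (splits (proj₂ p)) (λ q → Φ (proj₁ p) (proj₁ q) (proj₂ q)))

  -- Both enumerations give the same sum: each letter goes to A, B or C.
  ∑-split-left≈right : ∀ w Φ → ∑-split-left w Φ ≈ ∑-split-right w Φ
  ∑-split-left≈right [] Φ = refl
  ∑-split-left≈right (x ∷ w) Φ = begin
    ∑-split-left (x ∷ w) Φ ≈⟨ ∑-splits-∷ x w _ ⟩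
    ∑ (splits w) (λ p → ∑ (splits (x ∷ proj₁ p)) (λ q → Φ (proj₁ q) (proj₂ q) (proj₂ p)) + ∑ (splits (proj₁ p)) (λ q → Φ (proj₁ q) (proj₂ q) (x ∷ proj₂ p)))
      ≈⟨ ∑-cong (splits w) (λ p → +-cong (∑-splits-∷ x (proj₁ p) _) refl) ⟩
    ∑ (splits w) (λ p → ∑ (splits (proj₁ p)) (λ q → Φ (x ∷ proj₁ q) (proj₂ q) (proj₂ p) + Φ (proj₁ q) (x ∷ proj₂ q) (proj₂ p)) + ∑ (splits (proj₁ p)) (λ q → Φ (proj₁ q) (proj₂ q) (x ∷ proj₂ p)))
      ≈⟨ ∑-cong (splits w) (λ p → sym (∑-+ (splits (proj₁ p)) _ _)) ⟩
    ∑-split-left w Φₓ ≈⟨ ∑-split-left≈right w Φₓ ⟩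
    ∑-split-right w Φₓ ≈⟨ ∑-cong (splits w) (λ p → ∑-cong (splits (proj₂ p)) (λ q → +-assoc _ _ _)) ⟩
    ∑ (splits w) (λ p → ∑ (splits (proj₂ p)) (λ q → Φ (x ∷ proj₁ p) (proj₁ q) (proj₂ q) + (Φ (proj₁ p) (x ∷ proj₁ q) (proj₂ q) + Φ (proj₁ p) (proj₁ q) (x ∷ proj₂ q))))
      ≈⟨ ∑-cong (splits w) (λ p → ∑-+ (splits (proj₂ p)) _ _) ⟩
    ∑ (splits w) (λ p → ∑ (splits (proj₂ p)) (λ q → Φ (x ∷ proj₁ p) (proj₁ q) (proj₂ q)) + ∑ (splits (proj₂ p)) (λ q → Φ (proj₁ p) (x ∷ proj₁ q) (proj₂ q) + Φ (proj₁ p) (proj₁ q) (x ∷ proj₂ q)))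
      ≈⟨ ∑-cong (splits w) (λ p → +-cong refl (sym (∑-splits-∷ x (proj₂ p) _))) ⟩
    ∑ (splits w) (λ p → ∑ (splits (proj₂ p)) (λ q → Φ (x ∷ proj₁ p) (proj₁ q) (proj₂ q)) + ∑ (splits (x ∷ proj₂ p)) (λ q → Φ (proj₁ p) (proj₁ q) (proj₂ q)))
      ≈⟨ sym (∑-splits-∷ x w _) ⟩
    ∑-split-right (x ∷ w) Φ ∎
    where
    -- the three places the letter x can go
    Φₓ : Word → Word → Word → Carrier
    Φₓ a b c = (Φ (x ∷ a) b c + Φ a (x ∷ b) c) + Φ a b (x ∷ c)

  ∑-splits-εˡ : ∀ w (K : Word × Word → Carrier) → ∑ (splits w) (λ p → εw (proj₁ p) * K p) ≈ K ([] , w)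
  ∑-splits-εˡ [] K = trans (+-identityʳ _) (*-identityˡ _)
  ∑-splits-εˡ (x ∷ w) K = trans (∑-splits-∷ x w _)
    (trans (∑-cong (splits w) (λ q → trans (+-cong (zeroˡ _) refl) (+-identityˡ _)))
      (∑-splits-εˡ w (λ q → K (proj₁ q , x ∷ proj₂ q))))

  ∑-splits-εʳ : ∀ w (K : Word × Word → Carrier) → ∑ (splits w) (λ p → εw (proj₂ p) * K p) ≈ K (w , [])
  ∑-splits-εʳ [] K = trans (+-identityʳ _) (*-identityˡ _)
  ∑-splits-εʳ (x ∷ w) K = trans (∑-splits-∷ x w _)
    (trans (∑-cong (splits w) (λ q → trans (+-cong refl (zeroˡ _)) (+-identityʳ _)))
      (∑-splits-εʳ w (λ q → K (x ∷ proj₁ q , proj₂ q))))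

  εw-map : ∀ (f : ℕ → ℕ) l → εw (map f l) ≡ εw l
  εw-map f [] = P.refl
  εw-map f (x ∷ l) = P.refl

  εw-⋆ : ∀ u v → εw (u ⋆ v) ≈ εw u * εw v
  εw-⋆ [] [] = sym (*-identityˡ _)
  εw-⋆ [] (x ∷ v) = sym (*-identityˡ _)
  εw-⋆ (x ∷ u) v = sym (zeroˡ _)

  ∑-Δw-εˡ : ∀ {w} → Packed w → ∀ (G : Word → Carrier) → ∑ (Δw w) (λ p → εw (proj₁ p) * G (proj₂ p)) ≈ G w
  ∑-Δw-εˡ {w} packed G = begin
    ∑ (Δw w) (λ p → εw (proj₁ p) * G (proj₂ p)) ≡⟨ ∑-Δw w _ ⟩
    ∑ (splits w) (λ r → εw (pack (proj₁ r)) * G (pack (proj₂ r / proj₁ r)))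
      ≈⟨ ∑-cong (splits w) (λ r → *-cong (reflexive (εw-map _ (proj₁ r))) refl) ⟩
    ∑ (splits w) (λ r → εw (proj₁ r) * G (pack (proj₂ r / proj₁ r))) ≈⟨ ∑-splits-εˡ w (λ r → G (pack (proj₂ r / proj₁ r))) ⟩
    G (pack (w / [])) ≡⟨ P.cong (λ z → G (pack z)) (/-[] w) ⟩
    G (pack w) ≡⟨ P.cong G packed ⟩
    G w ∎

  ∑-Δw-εʳ : ∀ {w} → Packed w → ∀ (G : Word → Carrier) → ∑ (Δw w) (λ p → εw (proj₂ p) * G (proj₁ p)) ≈ G w
  ∑-Δw-εʳ {w} packed G = begin
    ∑ (Δw w) (λ p → εw (proj₂ p) * G (proj₁ p)) ≡⟨ ∑-Δw w _ ⟩
    ∑ (splits w) (λ r → εw (pack (proj₂ r / proj₁ r)) * G (pack (proj₁ r)))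
      ≈⟨ ∑-cong (splits w) (λ r → *-cong (reflexive (P.trans (εw-map _ (proj₂ r / proj₁ r)) (εw-map _ (proj₂ r)))) refl) ⟩
    ∑ (splits w) (λ r → εw (proj₂ r) * G (pack (proj₁ r))) ≈⟨ ∑-splits-εʳ w (λ r → G (pack (proj₁ r))) ⟩
    G (pack w) ≡⟨ P.cong G packed ⟩
    G w ∎

  ⟦mul⟧ : ∀ x y G → ⟦ mul x y ⟧ G ≈ ⟦ x ⟧ (λ u → ⟦ y ⟧ (λ v → G (u ⋆ v)))
  ⟦mul⟧ x y G = trans (⟦⟧-extend (λ u → extend (λ v → (1# , u ⋆ v) ∷ []) y) x G)
    (⟦⟧-cong x (λ u → trans (⟦⟧-extend (λ v → (1# , u ⋆ v) ∷ []) y G) (⟦⟧-cong y (λ v → ⟦⟧-basis (u ⋆ v) G))))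

  ⟦mul2⟧ : ∀ x y G → ⟦ mul2 x y ⟧ G ≈ ⟦ x ⟧ (λ p → ⟦ y ⟧ (λ q → G (proj₁ p ⋆ proj₁ q , proj₂ p ⋆ proj₂ q)))
  ⟦mul2⟧ x y G = trans (⟦⟧-extend (λ p → extend (λ q → (1# , (proj₁ p ⋆ proj₁ q , proj₂ p ⋆ proj₂ q)) ∷ []) y) x G)
    (⟦⟧-cong x (λ p → trans (⟦⟧-extend (λ q → (1# , (proj₁ p ⋆ proj₁ q , proj₂ p ⋆ proj₂ q)) ∷ []) y G)
                            (⟦⟧-cong y (λ q → ⟦⟧-basis _ G))))

  ⟦Δ⟧ : ∀ x G → ⟦ Δ x ⟧ G ≈ ⟦ x ⟧ (λ w → ∑ (Δw w) G)
  ⟦Δ⟧ x G = trans (⟦⟧-extend _ x G) (⟦⟧-cong x (λ w → ⟦⟧-ones (Δw w) G))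

  ∑-Δ-basis : ∀ w (F : W2 → Carrier) → ∑ (Δ ((1# , w) ∷ [])) (F ∘ proj₂) ≈ ∑ (Δw w) F
  ∑-Δ-basis w F = begin
    ∑ (Δ ((1# , w) ∷ [])) (F ∘ proj₂) ≈⟨ ∑-++ (scale 1# (map (λ p → 1# , p) (Δw w))) [] _ ⟩
    ∑ (scale 1# (map (λ p → 1# , p) (Δw w))) (F ∘ proj₂) + 0# ≈⟨ +-identityʳ _ ⟩
    ∑ (scale 1# (map (λ p → 1# , p) (Δw w))) (F ∘ proj₂) ≡⟨ ∑-map _ (map (λ p → 1# , p) (Δw w)) _ ⟩
    ∑ (map (λ p → 1# , p) (Δw w)) (F ∘ proj₂) ≡⟨ ∑-map _ (Δw w) _ ⟩
    ∑ (Δw w) F ∎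

  ⟦unit-coefficients⟧ : ∀ (l : Lin W2) (h : W2 → W3) G → ⟦ map (λ q → 1# , h (proj₂ q)) l ⟧ G ≈ ∑ l (G ∘ h ∘ proj₂)
  ⟦unit-coefficients⟧ l h G = trans (reflexive (∑-map _ l _)) (∑-cong l (λ q → *-identityˡ _))

  ⟦Δ⊗id⟧ : ∀ y G → ⟦ Δ⊗id y ⟧ G ≈ ⟦ y ⟧ (λ p → ∑ (Δw (proj₁ p)) (λ q → G (proj₁ q , proj₂ q , proj₂ p)))
  ⟦Δ⊗id⟧ y G = trans (⟦⟧-extend _ y G) (⟦⟧-cong y (λ p →
    trans (⟦unit-coefficients⟧ (Δ ((1# , proj₁ p) ∷ [])) (λ q → proj₁ q , proj₂ q , proj₂ p) G)
          (∑-Δ-basis (proj₁ p) (λ q → G (proj₁ q , proj₂ q , proj₂ p)))))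

  ⟦id⊗Δ⟧ : ∀ y G → ⟦ id⊗Δ y ⟧ G ≈ ⟦ y ⟧ (λ p → ∑ (Δw (proj₂ p)) (λ q → G (proj₁ p , proj₁ q , proj₂ q)))
  ⟦id⊗Δ⟧ y G = trans (⟦⟧-extend _ y G) (⟦⟧-cong y (λ p →
    trans (⟦unit-coefficients⟧ (Δ ((1# , proj₂ p) ∷ [])) (λ q → proj₁ p , proj₁ q , proj₂ q) G)
          (∑-Δ-basis (proj₂ p) (λ q → G (proj₁ p , proj₁ q , proj₂ q)))))

  ⟦ηε⟧ : ∀ x G → ⟦ ηε x ⟧ G ≈ ⟦ x ⟧ (λ w → εw w * G [])
  ⟦ηε⟧ x G = trans (+-identityʳ _) (trans (*-comm _ _) (trans (sym (⟦⟧-* x (G []) εw)) (⟦⟧-cong x (λ w → *-comm _ _))))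

  All-extend : ∀ {B C : Set} {Q : B → Set} {R : C → Set} (f : B → Lin C) (x : Lin B)
    → All (λ p → Q (proj₂ p)) x → (∀ {b} → Q b → All (λ p → R (proj₂ p)) (f b))
    → All (λ p → R (proj₂ p)) (extend f x)
  All-extend f [] [] h = []
  All-extend f ((a , b) ∷ x) (q ∷ qs) h = AllP.++⁺ (AllP.map⁺ (All.map (λ r → r) (h q))) (All-extend f x qs h)

  Δw-packed : ∀ w → All (λ p → Packed (proj₁ p) × Packed (proj₂ p)) (Δw w)
  Δw-packed w = AllP.map⁺ (All.universal (λ r → pack-idem _ , pack-idem _) (splits w))

  mul-closed : ∀ x y → InH x → InH y → InH (mul x y)
  mul-closed x y x∈H y∈H = All-extend _ x x∈H (λ {u} pu → All-extend _ y y∈H (λ {v} pv → Packed-⋆ u v pu pv ∷ []))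

  unit-closed : InH unit
  unit-closed = P.refl ∷ []

  Δ-closed : ∀ x → InH x → InH⊗H (Δ x)
  Δ-closed x x∈H = All-extend _ x x∈H (λ {w} _ → AllP.map⁺ (Δw-packed w))

  -- each structure map is computed through evaluations, which respect ≋
  mul-cong : ∀ x x' y y' → x ≋ x' → y ≋ y' → mul x y ≋ mul x' y'
  mul-cong x x' y y' x≋x' y≋y' = E₁.⟦⟧⇒Eq (mul x y) (mul x' y') λ G → begin
    ⟦ mul x y ⟧ G ≈⟨ ⟦mul⟧ x y G ⟩
    ⟦ x ⟧ (λ u → ⟦ y ⟧ (λ v → G (u ⋆ v))) ≈⟨ E₁.Eq⇒⟦⟧ x x' x≋x' _ ⟩
    ⟦ x' ⟧ (λ u → ⟦ y ⟧ (λ v → G (u ⋆ v))) ≈⟨ ⟦⟧-cong x' (λ u → E₁.Eq⇒⟦⟧ y y' y≋y' _) ⟩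
    ⟦ x' ⟧ (λ u → ⟦ y' ⟧ (λ v → G (u ⋆ v))) ≈⟨ sym (⟦mul⟧ x' y' G) ⟩
    ⟦ mul x' y' ⟧ G ∎

  Δ-cong : ∀ x y → x ≋ y → Δ x ≋2 Δ y
  Δ-cong x y x≋y = E₂.⟦⟧⇒Eq (Δ x) (Δ y) λ G → trans (⟦Δ⟧ x G) (trans (E₁.Eq⇒⟦⟧ x y x≋y _) (sym (⟦Δ⟧ y G)))

  ε-cong : ∀ x y → x ≋ y → ε x ≈ ε y
  ε-cong x y x≋y = E₁.Eq⇒⟦⟧ x y x≋y εw

  -- The algebra axioms follow from the monoid laws of ⋆.

  mul-assoc : ∀ x y z → mul (mul x y) z ≋ mul x (mul y z)
  mul-assoc x y z = E₁.⟦⟧⇒Eq (mul (mul x y) z) (mul x (mul y z)) λ G → begin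
    ⟦ mul (mul x y) z ⟧ G ≈⟨ ⟦mul⟧ (mul x y) z G ⟩
    ⟦ mul x y ⟧ (λ t → ⟦ z ⟧ (λ w → G (t ⋆ w))) ≈⟨ ⟦mul⟧ x y _ ⟩
    ⟦ x ⟧ (λ u → ⟦ y ⟧ (λ v → ⟦ z ⟧ (λ w → G ((u ⋆ v) ⋆ w))))
      ≈⟨ ⟦⟧-cong x (λ u → ⟦⟧-cong y (λ v → ⟦⟧-cong z (λ w → reflexive (P.cong G (⋆-assoc u v w))))) ⟩
    ⟦ x ⟧ (λ u → ⟦ y ⟧ (λ v → ⟦ z ⟧ (λ w → G (u ⋆ (v ⋆ w))))) ≈⟨ ⟦⟧-cong x (λ u → sym (⟦mul⟧ y z _)) ⟩
    ⟦ x ⟧ (λ u → ⟦ mul y z ⟧ (λ t → G (u ⋆ t))) ≈⟨ sym (⟦mul⟧ x (mul y z) G) ⟩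
    ⟦ mul x (mul y z) ⟧ G ∎

  mul-identityˡ : ∀ x → mul unit x ≋ x
  mul-identityˡ x = E₁.⟦⟧⇒Eq (mul unit x) x λ G → trans (⟦mul⟧ unit x G)
    (trans (⟦⟧-basis [] (λ u → ⟦ x ⟧ (λ v → G (u ⋆ v)))) (⟦⟧-cong x (λ v → reflexive (P.cong G (⋆-identityˡ v)))))

  mul-identityʳ : ∀ x → mul x unit ≋ x
  mul-identityʳ x = E₁.⟦⟧⇒Eq (mul x unit) x λ G → trans (⟦mul⟧ x unit G)
    (⟦⟧-cong x (λ u → trans (⟦⟧-basis [] (λ v → G (u ⋆ v))) (reflexive (P.cong G (⋆-identityʳ u)))))

  -- Coassociativity.  For a single word both sides enumerate the
  -- three-part splittings (A, B, C) of w with the term  triple A B C.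

  Δw-coassoc : ∀ w (G : W3 → Carrier) →
    ∑ (Δw w) (λ p → ∑ (Δw (proj₁ p)) (λ q → G (proj₁ q , proj₂ q , proj₂ p))) ≈
    ∑ (Δw w) (λ p → ∑ (Δw (proj₂ p)) (λ q → G (proj₁ p , proj₁ q , proj₂ q)))
  Δw-coassoc w G = begin
    ∑ (Δw w) (λ p → ∑ (Δw (proj₁ p)) (λ q → G (proj₁ q , proj₂ q , proj₂ p))) ≡⟨ ∑-Δw w _ ⟩
    ∑ (splits w) (λ r → ∑ (Δw (pack (proj₁ r))) (λ q → G (proj₁ q , proj₂ q , pack (proj₂ r / proj₁ r))))
      ≈⟨ ∑-cong (splits w) (λ r → reflexive (∑-Δw-map (φ (proj₁ r)) (proj₁ r) _)) ⟩
    ∑ (splits w) (λ r → ∑ (splits (proj₁ r)) (λ s → G (proj₁ (coterm (mapPair (φ (proj₁ r)) s)) ,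
                                                      proj₂ (coterm (mapPair (φ (proj₁ r)) s)) , pack (proj₂ r / proj₁ r))))
      ≈⟨ ∑-cong (splits w) (λ r → ∑-cong-∈ (splits (proj₁ r)) (λ s∈ →
           reflexive (P.cong G (split-left-factor (proj₂ r) (splits-interleaving (proj₁ r) s∈))))) ⟩
    ∑-split-left w (λ A B C → G (triple A B C)) ≈⟨ ∑-split-left≈right w _ ⟩
    ∑-split-right w (λ A B C → G (triple A B C))
      ≈⟨ ∑-cong (splits w) (λ r → ∑-cong-∈ (splits (proj₂ r)) (λ s∈ →
           reflexive (P.cong G (P.sym (split-right-factor (proj₁ r) (splits-interleaving (proj₂ r) s∈)))))) ⟩
    ∑ (splits w) (λ r → ∑ (splits (proj₂ r)) (λ s → G (pack (proj₁ r) , coterm (mapPair (φ (proj₂ r / proj₁ r)) (mapPair (erase (proj₁ r)) s)))))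
      ≈⟨ ∑-cong (splits w) (λ r → reflexive (P.sym (P.trans (∑-Δw-map (φ (proj₂ r / proj₁ r)) (proj₂ r / proj₁ r) _)
                                                   (∑-splits-map (erase (proj₁ r)) (proj₂ r) _)))) ⟩
    ∑ (splits w) (λ r → ∑ (Δw (pack (proj₂ r / proj₁ r))) (λ q → G (pack (proj₁ r) , proj₁ q , proj₂ q))) ≡⟨ P.sym (∑-Δw w _) ⟩
    ∑ (Δw w) (λ p → ∑ (Δw (proj₂ p)) (λ q → G (proj₁ p , proj₁ q , proj₂ q))) ∎

  Δ-coassoc : ∀ x → Δ⊗id (Δ x) ≋3 id⊗Δ (Δ x)
  Δ-coassoc x = E₃.⟦⟧⇒Eq (Δ⊗id (Δ x)) (id⊗Δ (Δ x)) λ G → begin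
    ⟦ Δ⊗id (Δ x) ⟧ G ≈⟨ ⟦Δ⊗id⟧ (Δ x) G ⟩
    ⟦ Δ x ⟧ (λ p → ∑ (Δw (proj₁ p)) (λ q → G (proj₁ q , proj₂ q , proj₂ p))) ≈⟨ ⟦Δ⟧ x _ ⟩
    ⟦ x ⟧ (λ w → ∑ (Δw w) (λ p → ∑ (Δw (proj₁ p)) (λ q → G (proj₁ q , proj₂ q , proj₂ p)))) ≈⟨ ⟦⟧-cong x (λ w → Δw-coassoc w G) ⟩
    ⟦ x ⟧ (λ w → ∑ (Δw w) (λ p → ∑ (Δw (proj₂ p)) (λ q → G (proj₁ p , proj₁ q , proj₂ q)))) ≈⟨ sym (⟦Δ⟧ x _) ⟩
    ⟦ Δ x ⟧ (λ p → ∑ (Δw (proj₂ p)) (λ q → G (proj₁ p , proj₁ q , proj₂ q))) ≈⟨ sym (⟦id⊗Δ⟧ (Δ x) G) ⟩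
    ⟦ id⊗Δ (Δ x) ⟧ G ∎

  -- Counit laws: only the splitting with an empty counit side survives.
  ε-counitˡ : ∀ x → InH x → ε⊗id (Δ x) ≋ x
  ε-counitˡ x x∈H = E₁.⟦⟧⇒Eq (ε⊗id (Δ x)) x λ G → begin
    ⟦ ε⊗id (Δ x) ⟧ G ≈⟨ ⟦⟧-extend (λ p → (εw (proj₁ p) , proj₂ p) ∷ []) (Δ x) G ⟩
    ⟦ Δ x ⟧ (λ p → ⟦ (εw (proj₁ p) , proj₂ p) ∷ [] ⟧ G) ≈⟨ ⟦⟧-cong (Δ x) (λ p → ⟦⟧-single (εw (proj₁ p)) (proj₂ p) G) ⟩
    ⟦ Δ x ⟧ (λ p → εw (proj₁ p) * G (proj₂ p)) ≈⟨ ⟦Δ⟧ x _ ⟩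
    ⟦ x ⟧ (λ w → ∑ (Δw w) (λ p → εw (proj₁ p) * G (proj₂ p))) ≈⟨ ⟦⟧-cong-All x (All.map (λ packed → ∑-Δw-εˡ packed G) x∈H) ⟩
    ⟦ x ⟧ G ∎

  ε-counitʳ : ∀ x → InH x → id⊗ε (Δ x) ≋ x
  ε-counitʳ x x∈H = E₁.⟦⟧⇒Eq (id⊗ε (Δ x)) x λ G → begin
    ⟦ id⊗ε (Δ x) ⟧ G ≈⟨ ⟦⟧-extend (λ p → (εw (proj₂ p) , proj₁ p) ∷ []) (Δ x) G ⟩
    ⟦ Δ x ⟧ (λ p → ⟦ (εw (proj₂ p) , proj₁ p) ∷ [] ⟧ G) ≈⟨ ⟦⟧-cong (Δ x) (λ p → ⟦⟧-single (εw (proj₂ p)) (proj₁ p) G) ⟩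
    ⟦ Δ x ⟧ (λ p → εw (proj₂ p) * G (proj₁ p)) ≈⟨ ⟦Δ⟧ x _ ⟩
    ⟦ x ⟧ (λ w → ∑ (Δw w) (λ p → εw (proj₂ p) * G (proj₁ p))) ≈⟨ ⟦⟧-cong-All x (All.map (λ packed → ∑-Δw-εʳ packed G) x∈H) ⟩
    ⟦ x ⟧ G ∎

  -- Δ and ε are multiplicative.  For words, the splittings of u ⋆ v are the
  -- pairs of splittings of u and v, and coterm turns concatenation into ⋆.

  Δw-⋆ : ∀ u v (G : W2 → Carrier) → ∑ (Δw (u ⋆ v)) G ≈
    ∑ (Δw u) (λ p → ∑ (Δw v) (λ q → G (proj₁ p ⋆ proj₁ q , proj₂ p ⋆ proj₂ q)))
  Δw-⋆ u v G = begin
    ∑ (Δw (u ⋆ v)) G ≡⟨ ∑-Δw (u ⋆ v) G ⟩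
    ∑ (splits (u ++ T (sup u) v)) (G ∘ coterm) ≡⟨ P.cong (λ z → ∑ (splits (u ++ z)) (G ∘ coterm)) (T≡map-shift (sup u) v) ⟩
    ∑ (splits (u ++ map (shift (sup u)) v)) (G ∘ coterm) ≈⟨ ∑-splits-++ u _ _ ⟩
    ∑ (splits u) (λ p → ∑ (splits (map (shift (sup u)) v)) (λ q → G (coterm (proj₁ p ++ proj₁ q , proj₂ p ++ proj₂ q))))
      ≈⟨ ∑-cong (splits u) (λ p → reflexive (∑-splits-map (shift (sup u)) v _)) ⟩
    ∑ (splits u) (λ p → ∑ (splits v) (λ q → G (coterm (proj₁ p ++ map (shift (sup u)) (proj₁ q) , proj₂ p ++ map (shift (sup u)) (proj₂ q)))))
      ≈⟨ ∑-cong-∈ (splits u) (λ {p} p∈ → ∑-cong (splits v) (λ q → reflexive (P.cong G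
           (coterm-shift (sup u) p q (sup-∈ ∘ ⊆-left (splits-interleaving u p∈)) (sup-∈ ∘ ⊆-right (splits-interleaving u p∈)))))) ⟩
    ∑ (splits u) (λ p → ∑ (splits v) (λ q → G (proj₁ (coterm p) ⋆ proj₁ (coterm q) , proj₂ (coterm p) ⋆ proj₂ (coterm q))))
      ≈⟨ ∑-cong (splits u) (λ p → reflexive (P.sym (∑-Δw v _))) ⟩
    ∑ (splits u) (λ p → ∑ (Δw v) (λ q → G (proj₁ (coterm p) ⋆ proj₁ q , proj₂ (coterm p) ⋆ proj₂ q))) ≡⟨ P.sym (∑-Δw u _) ⟩
    ∑ (Δw u) (λ p → ∑ (Δw v) (λ q → G (proj₁ p ⋆ proj₁ q , proj₂ p ⋆ proj₂ q))) ∎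

  Δ-mul : ∀ x y → Δ (mul x y) ≋2 mul2 (Δ x) (Δ y)
  Δ-mul x y = E₂.⟦⟧⇒Eq (Δ (mul x y)) (mul2 (Δ x) (Δ y)) λ G → let G⋆ = λ (p q : W2) → G (proj₁ p ⋆ proj₁ q , proj₂ p ⋆ proj₂ q) in begin
    ⟦ Δ (mul x y) ⟧ G ≈⟨ ⟦Δ⟧ (mul x y) G ⟩
    ⟦ mul x y ⟧ (λ w → ∑ (Δw w) G) ≈⟨ ⟦mul⟧ x y _ ⟩
    ⟦ x ⟧ (λ u → ⟦ y ⟧ (λ v → ∑ (Δw (u ⋆ v)) G)) ≈⟨ ⟦⟧-cong x (λ u → ⟦⟧-cong y (λ v → Δw-⋆ u v G)) ⟩
    ⟦ x ⟧ (λ u → ⟦ y ⟧ (λ v → ∑ (Δw u) (λ p → ∑ (Δw v) (λ q → G⋆ p q))))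
      ≈⟨ ⟦⟧-cong x (λ u → ⟦⟧-∑ y (Δw u) (λ v p → ∑ (Δw v) (λ q → G⋆ p q))) ⟩
    ⟦ x ⟧ (λ u → ∑ (Δw u) (λ p → ⟦ y ⟧ (λ v → ∑ (Δw v) (λ q → G⋆ p q))))
      ≈⟨ ⟦⟧-cong x (λ u → ∑-cong (Δw u) (λ p → sym (⟦Δ⟧ y (G⋆ p)))) ⟩
    ⟦ x ⟧ (λ u → ∑ (Δw u) (λ p → ⟦ Δ y ⟧ (G⋆ p))) ≈⟨ sym (⟦Δ⟧ x _) ⟩
    ⟦ Δ x ⟧ (λ p → ⟦ Δ y ⟧ (G⋆ p)) ≈⟨ sym (⟦mul2⟧ (Δ x) (Δ y) G) ⟩
    ⟦ mul2 (Δ x) (Δ y) ⟧ G ∎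

  Δ-unit : Δ unit ≋2 unit2
  Δ-unit = E₂.⟦⟧⇒Eq (Δ unit) unit2 λ G →
    trans (⟦Δ⟧ unit G) (trans (⟦⟧-basis [] (λ w → ∑ (Δw w) G)) (trans (+-identityʳ _) (sym (⟦⟧-basis ([] , []) G))))

  ε-mul : ∀ x y → ε (mul x y) ≈ ε x * ε y
  ε-mul x y = begin
    ⟦ mul x y ⟧ εw ≈⟨ ⟦mul⟧ x y εw ⟩
    ⟦ x ⟧ (λ u → ⟦ y ⟧ (λ v → εw (u ⋆ v))) ≈⟨ ⟦⟧-cong x (λ u → ⟦⟧-cong y (λ v → εw-⋆ u v)) ⟩
    ⟦ x ⟧ (λ u → ⟦ y ⟧ (λ v → εw u * εw v)) ≈⟨ ⟦⟧-cong x (λ u → trans (⟦⟧-* y (εw u) εw) (*-comm _ _)) ⟩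
    ⟦ x ⟧ (λ u → ⟦ y ⟧ εw * εw u) ≈⟨ ⟦⟧-* x (⟦ y ⟧ εw) εw ⟩
    ⟦ y ⟧ εw * ⟦ x ⟧ εw ≈⟨ *-comm _ _ ⟩
    ⟦ x ⟧ εw * ⟦ y ⟧ εw ∎

  ε-unit : ε unit ≈ 1#
  ε-unit = ⟦⟧-basis [] εw

  -- Convolution.  A map f : H → H is recorded by the functional
  -- (w , G) ↦ ⟦ f(w) ⟧ G, and the convolution  m ∘ (f ⊗ g) ∘ Δ  by conv.

  Functional : Set c
  Functional = Word → (Word → Carrier) → Carrier

  record IsLinearFunctional (F : Functional) : Set (c Level.⊔ ℓ) where
    field
      F-cong : ∀ w {G G'} → (∀ a → G a ≈ G' a) → F w G ≈ F w G'
      F-+ : ∀ w G G' → F w (λ a → G a + G' a) ≈ F w G + F w G'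
      F-* : ∀ w c G → F w (λ a → c * G a) ≈ c * F w G
      F-0 : ∀ w → F w (λ _ → 0#) ≈ 0#

  open IsLinearFunctional

  F-∑ : ∀ {F} → IsLinearFunctional F → ∀ w (l : List A) (K : Word → A → Carrier) → F w (λ a → ∑ l (K a)) ≈ ∑ l (λ y → F w (λ a → K a y))
  F-∑ lin w [] K = F-0 lin w
  F-∑ lin w (y ∷ l) K = trans (F-+ lin w _ _) (+-cong refl (F-∑ lin w l K))

  conv : Functional → Functional → Functional
  conv F H w G = ∑ (Δw w) (λ p → F (proj₁ p) (λ a → H (proj₂ p) (λ b → G (a ⋆ b))))

  idF ηεF : Functional
  idF w G = G w
  ηεF w G = εw w * G []

  functional : (Word → Lin Word) → Functional
  functional S w G = ⟦ S w ⟧ G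

  functional-linear : ∀ S → IsLinearFunctional (functional S)
  functional-linear S = record { F-cong = λ w h → ⟦⟧-cong (S w) h ; F-+ = λ w G G' → ⟦⟧-+ (S w) G G'
                               ; F-* = λ w c G → ⟦⟧-* (S w) c G ; F-0 = λ w → ⟦⟧-0 (S w) }

  idF-linear : IsLinearFunctional idF
  idF-linear = record { F-cong = λ w h → h w ; F-+ = λ _ _ _ → refl ; F-* = λ _ _ _ → refl ; F-0 = λ _ → refl }

  -- convolution is associative, by coassociativity and associativity of ⋆
  conv-assoc : ∀ {F H K} → IsLinearFunctional F → IsLinearFunctional H → IsLinearFunctional K →
    ∀ w G → conv (conv F H) K w G ≈ conv F (conv H K) w G
  conv-assoc {F} {H} {K} linF linH linK w G = begin
    conv (conv F H) K w G ≈⟨ ∑-cong (Δw w) (λ p → ∑-cong (Δw (proj₁ p)) (λ q →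
      F-cong linF (proj₁ q) (λ a₁ → F-cong linH (proj₂ q) (λ a₂ → F-cong linK (proj₂ p) (λ a₃ → reflexive (P.cong G (⋆-assoc a₁ a₂ a₃))))))) ⟩
    ∑ (Δw w) (λ p → ∑ (Δw (proj₁ p)) (λ q → Ψ (proj₁ q , proj₂ q , proj₂ p))) ≈⟨ Δw-coassoc w Ψ ⟩
    ∑ (Δw w) (λ p → ∑ (Δw (proj₂ p)) (λ q → Ψ (proj₁ p , proj₁ q , proj₂ q)))
      ≈⟨ ∑-cong (Δw w) (λ p → sym (F-∑ linF (proj₁ p) (Δw (proj₂ p)) _)) ⟩
    conv F (conv H K) w G ∎
    where
    Ψ : W3 → Carrier
    Ψ t = F (proj₁ t) (λ a₁ → H (proj₁ (proj₂ t)) (λ a₂ → K (proj₂ (proj₂ t)) (λ a₃ → G (a₁ ⋆ (a₂ ⋆ a₃)))))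

  conv-congˡ : ∀ {F F'} H → (∀ {w} → Packed w → ∀ G → F w G ≈ F' w G) → ∀ w G → conv F H w G ≈ conv F' H w G
  conv-congˡ H same w G = ∑-cong-∈ (Δw w) (λ p∈ → same (proj₁ (All.lookup (Δw-packed w) p∈)) _)

  conv-congʳ : ∀ {H H'} F → IsLinearFunctional F → (∀ {w} → Packed w → ∀ G → H w G ≈ H' w G) →
    ∀ w G → conv F H w G ≈ conv F H' w G
  conv-congʳ F linF same w G = ∑-cong-∈ (Δw w) (λ {p} p∈ → F-cong linF (proj₁ p) (λ a → same (proj₂ (All.lookup (Δw-packed w) p∈)) _))

  conv-ηεʳ : ∀ {F} → IsLinearFunctional F → ∀ {w} → Packed w → ∀ G → conv F ηεF w G ≈ F w G
  conv-ηεʳ {F} linF {w} packed G = begin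
    conv F ηεF w G ≈⟨ ∑-cong (Δw w) (λ p → F-* linF (proj₁ p) (εw (proj₂ p)) (λ a → G (a ⋆ []))) ⟩
    ∑ (Δw w) (λ p → εw (proj₂ p) * F (proj₁ p) (λ a → G (a ⋆ []))) ≈⟨ ∑-Δw-εʳ packed (λ u → F u (λ a → G (a ⋆ []))) ⟩
    F w (λ a → G (a ⋆ [])) ≈⟨ F-cong linF w (λ a → reflexive (P.cong G (⋆-identityʳ a))) ⟩
    F w G ∎

  conv-ηεˡ : ∀ {H} → IsLinearFunctional H → ∀ {w} → Packed w → ∀ G → conv ηεF H w G ≈ H w G
  conv-ηεˡ {H} linH {w} packed G = begin
    conv ηεF H w G ≈⟨ ∑-Δw-εˡ packed (λ v → H v (λ b → G ([] ⋆ b))) ⟩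
    H w (λ b → G ([] ⋆ b)) ≈⟨ F-cong linH w (λ b → reflexive (P.cong G (⋆-identityˡ b))) ⟩
    H w G ∎

  -- Writing Δ(w) = w ⊗ 1 + Σ' u ⊗ v, the equation
  -- S ∗ id = η ∘ ε forces  S(w) = - Σ' S(u) v ; dually  id ∗ S' = η ∘ ε
  -- forces  S'(w) = - Σ' u S'(v).  The recursion is on the length of the
  -- word, given as fuel.

  leftInverse rightInverse : ℕ → Word → Lin Word
  leftInverse zero w = unit
  leftInverse (suc n) [] = unit
  leftInverse (suc n) (x ∷ w) =
    scale (- 1#) (concatMap (λ p → mul (leftInverse n (proj₁ p)) ((1# , proj₂ p) ∷ [])) (properˡ (x ∷ w)))
  rightInverse zero w = unit
  rightInverse (suc n) [] = unit
  rightInverse (suc n) (x ∷ w) =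
    scale (- 1#) (concatMap (λ p → mul ((1# , proj₁ p) ∷ []) (rightInverse n (proj₂ p))) (properʳ (x ∷ w)))

  leftInverse-fuel : ∀ n m w → length w ≤ n → length w ≤ m → leftInverse n w ≡ leftInverse m w
  leftInverse-fuel zero zero [] _ _ = P.refl
  leftInverse-fuel zero (suc m) [] _ _ = P.refl
  leftInverse-fuel (suc n) zero [] _ _ = P.refl
  leftInverse-fuel (suc n) (suc m) [] _ _ = P.refl
  leftInverse-fuel (suc n) (suc m) (x ∷ w) (s≤s w≤n) (s≤s w≤m) =
    P.cong (scale (- 1#)) (concatMap-cong-∈ (properˡ (x ∷ w)) λ {p} p∈ →
      let shorter : length (proj₁ p) ≤ length w
          shorter = ≤-pred (properˡ-shorter (x ∷ w) p∈)
      in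
      P.cong (λ S → mul S ((1# , proj₂ p) ∷ [])) (leftInverse-fuel n m (proj₁ p) (≤-trans shorter w≤n) (≤-trans shorter w≤m)))

  rightInverse-fuel : ∀ n m w → length w ≤ n → length w ≤ m → rightInverse n w ≡ rightInverse m w
  rightInverse-fuel zero zero [] _ _ = P.refl
  rightInverse-fuel zero (suc m) [] _ _ = P.refl
  rightInverse-fuel (suc n) zero [] _ _ = P.refl
  rightInverse-fuel (suc n) (suc m) [] _ _ = P.refl
  rightInverse-fuel (suc n) (suc m) (x ∷ w) (s≤s w≤n) (s≤s w≤m) =
    P.cong (scale (- 1#)) (concatMap-cong-∈ (properʳ (x ∷ w)) λ {p} p∈ →
      let shorter : length (proj₂ p) ≤ length w
          shorter = ≤-pred (properʳ-shorter (x ∷ w) p∈)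
      in
      P.cong (λ S → mul ((1# , proj₁ p) ∷ []) S) (rightInverse-fuel n m (proj₂ p) (≤-trans shorter w≤n) (≤-trans shorter w≤m)))

  S-left S-right : Word → Lin Word
  S-left w = leftInverse (length w) w
  S-right w = rightInverse (length w) w

  ⟦leftInverse⟧ : ∀ n x w H → ⟦ leftInverse (suc n) (x ∷ w) ⟧ H ≈
    - 1# * ∑ (properˡ (x ∷ w)) (λ p → ⟦ leftInverse n (proj₁ p) ⟧ (λ a → H (a ⋆ proj₂ p)))
  ⟦leftInverse⟧ n x w H = trans (⟦⟧-scale (- 1#) (concatMap (λ p → mul (leftInverse n (proj₁ p)) ((1# , proj₂ p) ∷ [])) (properˡ (x ∷ w))) H) (*-cong refl
    (trans (∑-concatMap (λ p → mul (leftInverse n (proj₁ p)) ((1# , proj₂ p) ∷ [])) (properˡ (x ∷ w)) _)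
      (∑-cong (properˡ (x ∷ w)) (λ p → trans (⟦mul⟧ (leftInverse n (proj₁ p)) ((1# , proj₂ p) ∷ []) H)
         (⟦⟧-cong (leftInverse n (proj₁ p)) (λ a → ⟦⟧-basis (proj₂ p) (λ b → H (a ⋆ b))))))))

  ⟦rightInverse⟧ : ∀ n x w H → ⟦ rightInverse (suc n) (x ∷ w) ⟧ H ≈
    - 1# * ∑ (properʳ (x ∷ w)) (λ p → ⟦ rightInverse n (proj₂ p) ⟧ (λ b → H (proj₁ p ⋆ b)))
  ⟦rightInverse⟧ n x w H = trans (⟦⟧-scale (- 1#) (concatMap (λ p → mul ((1# , proj₁ p) ∷ []) (rightInverse n (proj₂ p))) (properʳ (x ∷ w))) H) (*-cong refl
    (trans (∑-concatMap (λ p → mul ((1# , proj₁ p) ∷ []) (rightInverse n (proj₂ p))) (properʳ (x ∷ w)) _)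
      (∑-cong (properʳ (x ∷ w)) (λ p → trans (⟦mul⟧ ((1# , proj₁ p) ∷ []) (rightInverse n (proj₂ p)) H)
         (⟦⟧-basis (proj₁ p) (λ a → ⟦ rightInverse n (proj₂ p) ⟧ (λ b → H (a ⋆ b))))))))

  cancel : ∀ R → - 1# * R + R ≈ 0#
  cancel R = trans (+-cong (-1*x≈-x R) refl) (-‿inverseˡ R)

  -- S-left is a left convolution inverse of the identity: split off the term w ⊗ 1
  -- of Δ(w), which contributes S-left(w), and the recursion cancels the rest
  S-left-inverse : ∀ w → Packed w → ∀ G → conv (functional S-left) idF w G ≈ ηεF w G
  S-left-inverse [] _ G = trans (+-identityʳ _) (+-identityʳ _)
  S-left-inverse (x ∷ w) packed G = begin
    ∑ (Δw (x ∷ w)) F ≈⟨ ∑-filter rightEmpty (Δw (x ∷ w)) F ⟩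
    ∑ (filterᵇ rightEmpty (Δw (x ∷ w))) F + R ≡⟨ P.cong (λ l → ∑ l F + R) (Δw-rightEmpty (x ∷ w)) ⟩
    (F (pack (x ∷ w) , []) + 0#) + R ≈⟨ +-cong (+-identityʳ _) refl ⟩
    F (pack (x ∷ w) , []) + R ≡⟨ P.cong (λ z → F (z , []) + R) packed ⟩
    ⟦ leftInverse (suc (length w)) (x ∷ w) ⟧ (λ a → G (a ⋆ [])) + R ≈⟨ +-cong (⟦leftInverse⟧ (length w) x w _) refl ⟩
    - 1# * ∑ (properˡ (x ∷ w)) (λ p → ⟦ leftInverse (length w) (proj₁ p) ⟧ (λ a → G ((a ⋆ proj₂ p) ⋆ []))) + R
      ≈⟨ +-cong (*-cong refl (∑-cong-∈ (properˡ (x ∷ w)) (λ {p} p∈ → trans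
           (reflexive (P.cong (λ S → ⟦ S ⟧ (λ a → G ((a ⋆ proj₂ p) ⋆ [])))
                  (leftInverse-fuel (length w) (length (proj₁ p)) (proj₁ p) (≤-pred (properˡ-shorter (x ∷ w) p∈)) ≤-refl)))
           (⟦⟧-cong (S-left (proj₁ p)) (λ a → reflexive (P.cong G (⋆-identityʳ (a ⋆ proj₂ p)))))))) refl ⟩
    - 1# * R + R ≈⟨ cancel R ⟩
    0# ≈⟨ sym (zeroˡ _) ⟩
    ηεF (x ∷ w) G ∎
    where
    F : W2 → Carrier
    F p = ⟦ S-left (proj₁ p) ⟧ (λ a → G (a ⋆ proj₂ p))
    R : Carrier
    R = ∑ (properˡ (x ∷ w)) F

  -- dually S-right is a right convolution inverse, splitting off the term 1 ⊗ w
  S-right-inverse : ∀ w → Packed w → ∀ G → conv idF (functional S-right) w G ≈ ηεF w G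
  S-right-inverse [] _ G = trans (+-identityʳ _) (+-identityʳ _)
  S-right-inverse (x ∷ w) packed G = begin
    ∑ (Δw (x ∷ w)) F ≈⟨ ∑-filter leftEmpty (Δw (x ∷ w)) F ⟩
    ∑ (filterᵇ leftEmpty (Δw (x ∷ w))) F + R ≡⟨ P.cong (λ l → ∑ l F + R) (Δw-leftEmpty (x ∷ w)) ⟩
    (F ([] , pack ((x ∷ w) / [])) + 0#) + R ≈⟨ +-cong (+-identityʳ _) refl ⟩
    F ([] , pack ((x ∷ w) / [])) + R ≡⟨ P.cong (λ z → F ([] , pack z) + R) (/-[] (x ∷ w)) ⟩
    F ([] , pack (x ∷ w)) + R ≡⟨ P.cong (λ z → F ([] , z) + R) packed ⟩
    ⟦ rightInverse (suc (length w)) (x ∷ w) ⟧ (λ b → G ([] ⋆ b)) + R ≈⟨ +-cong (⟦rightInverse⟧ (length w) x w _) refl ⟩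
    - 1# * ∑ (properʳ (x ∷ w)) (λ p → ⟦ rightInverse (length w) (proj₂ p) ⟧ (λ b → G ([] ⋆ (proj₁ p ⋆ b)))) + R
      ≈⟨ +-cong (*-cong refl (∑-cong-∈ (properʳ (x ∷ w)) (λ {p} p∈ → trans
           (reflexive (P.cong (λ S → ⟦ S ⟧ (λ b → G ([] ⋆ (proj₁ p ⋆ b))))
                  (rightInverse-fuel (length w) (length (proj₂ p)) (proj₂ p) (≤-pred (properʳ-shorter (x ∷ w) p∈)) ≤-refl)))
           (⟦⟧-cong (S-right (proj₂ p)) (λ b → reflexive (P.cong G (⋆-identityˡ (proj₁ p ⋆ b)))))))) refl ⟩
    - 1# * R + R ≈⟨ cancel R ⟩
    0# ≈⟨ sym (zeroˡ _) ⟩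
    ηεF (x ∷ w) G ∎
    where
    F : W2 → Carrier
    F p = ⟦ S-right (proj₂ p) ⟧ (λ b → G (proj₁ p ⋆ b))
    R : Carrier
    R = ∑ (properʳ (x ∷ w)) F

  -- A left and a right convolution inverse coincide:
  -- S = S ∗ (id ∗ S') = (S ∗ id) ∗ S' = S'.
  S-left≈S-right : ∀ {w} → Packed w → ∀ G → functional S-left w G ≈ functional S-right w G
  S-left≈S-right {w} packed G = begin
    SL w G ≈⟨ sym (conv-ηεʳ (functional-linear S-left) packed G) ⟩
    conv SL ηεF w G ≈⟨ conv-congʳ SL (functional-linear S-left) (λ packed' G' → sym (S-right-inverse _ packed' G')) w G ⟩
    conv SL (conv idF SR) w G ≈⟨ sym (conv-assoc (functional-linear S-left) idF-linear (functional-linear S-right) w G) ⟩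
    conv (conv SL idF) SR w G ≈⟨ conv-congˡ SR (λ packed' G' → S-left-inverse _ packed' G') w G ⟩
    conv ηεF SR w G ≈⟨ conv-ηεˡ (functional-linear S-right) packed G ⟩
    SR w G ∎
    where
    SL SR : Functional
    SL = functional S-left
    SR = functional S-right

  leftInverse-closed : ∀ n w → InH (leftInverse n w)
  leftInverse-closed zero w = P.refl ∷ []
  leftInverse-closed (suc n) [] = P.refl ∷ []
  leftInverse-closed (suc n) (x ∷ w) = AllP.map⁺ (All.map (λ packed → packed) (AllP.concat⁺ (AllP.map⁺ (All.tabulate λ {p} p∈ →
    mul-closed (leftInverse n (proj₁ p)) ((1# , proj₂ p) ∷ []) (leftInverse-closed n (proj₁ p))
      (proj₂ (All.lookup (Δw-packed (x ∷ w)) (proj₁ (∈-filter⁻ (T? ∘ not ∘ rightEmpty) p∈))) ∷ [])))))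

  antipode : Lin Word → Lin Word
  antipode = extend S-left

  ⟦antipode⟧ : ∀ x G → ⟦ antipode x ⟧ G ≈ ⟦ x ⟧ (λ w → functional S-left w G)
  ⟦antipode⟧ x G = ⟦⟧-extend S-left x G

  antipode-linear : IsLinearEndo antipode
  antipode-linear = record
    { preservesH = λ x x∈H → All-extend S-left x x∈H (λ {w} _ → leftInverse-closed (length w) w)
    ; cong = λ x y _ _ x≋y → E₁.⟦⟧⇒Eq (antipode x) (antipode y) λ G →
        trans (⟦antipode⟧ x G) (trans (E₁.Eq⇒⟦⟧ x y x≋y _) (sym (⟦antipode⟧ y G)))
    ; additive = λ x y _ _ → E₁.⟦⟧⇒Eq (antipode (x ++ y)) (antipode x ++ antipode y) λ G →
        trans (⟦antipode⟧ (x ++ y) G) (trans (⟦⟧-++ x y _)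
          (trans (+-cong (sym (⟦antipode⟧ x G)) (sym (⟦antipode⟧ y G))) (sym (⟦⟧-++ (antipode x) (antipode y) G))))
    ; homogeneous = λ a x _ → E₁.⟦⟧⇒Eq (antipode (scale a x)) (scale a (antipode x)) λ G →
        trans (⟦antipode⟧ (scale a x) G) (trans (⟦⟧-scale a x _)
          (trans (*-cong refl (sym (⟦antipode⟧ x G))) (sym (⟦⟧-scale a (antipode x) G))))
    }

  ⟦m∘⊗∘Δ⟧ : ∀ f g F H → (∀ w G → ⟦ f ((1# , w) ∷ []) ⟧ G ≈ F w G) → (∀ w G → ⟦ g ((1# , w) ∷ []) ⟧ G ≈ H w G) →
    ∀ x G → ⟦ m∘⊗ f g (Δ x) ⟧ G ≈ ⟦ x ⟧ (λ w → conv F H w G)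
  ⟦m∘⊗∘Δ⟧ f g F H f≈F g≈H x G = begin
    ⟦ m∘⊗ f g (Δ x) ⟧ G ≈⟨ ⟦⟧-extend (λ p → mul (f ((1# , proj₁ p) ∷ [])) (g ((1# , proj₂ p) ∷ []))) (Δ x) G ⟩
    ⟦ Δ x ⟧ (λ p → ⟦ mul (f ((1# , proj₁ p) ∷ [])) (g ((1# , proj₂ p) ∷ [])) ⟧ G)
      ≈⟨ ⟦⟧-cong (Δ x) (λ p → trans (⟦mul⟧ (f ((1# , proj₁ p) ∷ [])) (g ((1# , proj₂ p) ∷ [])) G)
           (trans (⟦⟧-cong (f ((1# , proj₁ p) ∷ [])) (λ a → g≈H (proj₂ p) (λ b → G (a ⋆ b)))) (f≈F (proj₁ p) _))) ⟩
    ⟦ Δ x ⟧ (λ p → F (proj₁ p) (λ a → H (proj₂ p) (λ b → G (a ⋆ b)))) ≈⟨ ⟦Δ⟧ x _ ⟩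
    ⟦ x ⟧ (λ w → conv F H w G) ∎

  antipode-basis : ∀ w G → ⟦ antipode ((1# , w) ∷ []) ⟧ G ≈ functional S-left w G
  antipode-basis w G = trans (⟦antipode⟧ ((1# , w) ∷ []) G) (⟦⟧-basis w (λ v → functional S-left v G))

  antipode-left : ∀ x → InH x → m∘⊗ antipode (λ y → y) (Δ x) ≋ ηε x
  antipode-left x x∈H = E₁.⟦⟧⇒Eq (m∘⊗ antipode (λ y → y) (Δ x)) (ηε x) λ G → begin
    ⟦ m∘⊗ antipode (λ y → y) (Δ x) ⟧ G ≈⟨ ⟦m∘⊗∘Δ⟧ antipode (λ y → y) (functional S-left) idF antipode-basis ⟦⟧-basis x G ⟩
    ⟦ x ⟧ (λ w → conv (functional S-left) idF w G) ≈⟨ ⟦⟧-cong-All x (All.map (λ packed → S-left-inverse _ packed G) x∈H) ⟩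
    ⟦ x ⟧ (λ w → ηεF w G) ≈⟨ sym (⟦ηε⟧ x G) ⟩
    ⟦ ηε x ⟧ G ∎

  antipode-right : ∀ x → InH x → m∘⊗ (λ y → y) antipode (Δ x) ≋ ηε x
  antipode-right x x∈H = E₁.⟦⟧⇒Eq (m∘⊗ (λ y → y) antipode (Δ x)) (ηε x) λ G → begin
    ⟦ m∘⊗ (λ y → y) antipode (Δ x) ⟧ G ≈⟨ ⟦m∘⊗∘Δ⟧ (λ y → y) antipode idF (functional S-left) ⟦⟧-basis antipode-basis x G ⟩
    ⟦ x ⟧ (λ w → conv idF (functional S-left) w G) ≈⟨ ⟦⟧-cong-All x (All.map (λ {p} packed →
      trans (conv-congʳ idF idF-linear S-left≈S-right (proj₂ p) G) (S-right-inverse (proj₂ p) packed G)) x∈H) ⟩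
    ⟦ x ⟧ (λ w → ηεF w G) ≈⟨ sym (⟦ηε⟧ x G) ⟩
    ⟦ ηε x ⟧ G ∎

theorem2 : {c ℓ : Level} (k : Field c ℓ) → FreeModule.IsHopfAlgebra k
theorem2 k = record
  { mul-closed = mul-closed
  ; unit-closed = unit-closed
  ; Δ-closed = Δ-closed
  ; mul-cong = λ x x' y y' _ _ _ _ → mul-cong x x' y y'
  ; Δ-cong = λ x y _ _ → Δ-cong x y
  ; ε-cong = λ x y _ _ → ε-cong x y
  ; mul-assoc = λ x y z _ _ _ → mul-assoc x y z
  ; mul-unitˡ = λ x _ → mul-identityˡ x
  ; mul-unitʳ = λ x _ → mul-identityʳ x
  ; Δ-coassoc = λ x _ → Δ-coassoc x
  ; ε-counitˡ = ε-counitˡ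
  ; ε-counitʳ = ε-counitʳ
  ; Δ-mul = λ x y _ _ → Δ-mul x y
  ; Δ-unit = Δ-unit
  ; ε-mul = λ x y _ _ → ε-mul x y
  ; ε-unit = ε-unit
  ; antipode = antipode
  ; antipode-linear = antipode-linear
  ; antipode-left = antipode-left
  ; antipode-right = antipode-right
  }
  where open Hopf k
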